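{- For every positive integer $n\equiv 0\pmod 4$ with $n\neq 4$, the complete graph $K_n$ has a $3$-null $1$-factorisation.
   Context: For a graph $G$ and positive integer $k$, a zero-sum $k$-flow of $G$ is a map $f:E(G)\to\{\pm1,\dots,\pm(k-1)\}$ such that the sum of $f$ over the edges incident with any vertex is $0$. A $1$-factorisation is a partition of $E(G)$ into $1$-factors (perfect matchings). $G$ has a $k$-null $1$-factorisation if there is a zero-sum $k$-flow $f$ of $G$ and a $1$-factorisation of $G$ in which every $1$-factor has weight zero, the weight of an edge set being the sum of the $f$-values of its edges. -}

module Defs where

open import Data.Nat using (ℕ; zero; suc; _<_)
open import Data.Fin using (Fin; zero; suc) renaming (_<_ to _<ᶠ_)
open import Data.Fin.Properties using (_<?_) renaming (_≟_ to _≟ᶠ_)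
open import Data.Integer using (ℤ; 0ℤ; _+_; ∣_∣)
open import Data.Product using (Σ; ∃; _×_; _,_)
open import Relation.Nullary using (¬_; Dec; yes; no)
open import Relation.Nullary.Decidable using (_×-dec_; ¬?)
open import Relation.Binary.PropositionalEquality using (_≡_; _≢_)

sumFin : (n : ℕ) → (Fin n → ℤ) → ℤ
sumFin zero    g = 0ℤ
sumFin (suc n) g = g zero + sumFin n (λ i → g (suc i))

when : ∀ {p} {P : Set p} → Dec P → ℤ → ℤ
when (yes _) x = x
when (no _)  _ = 0ℤ

-- The complete graph K_n has vertex set Fin n and exactly one edge {i,j}
-- for each pair i ≢ j.  A map on E(K_n) is represented by a symmetric
-- function Fin n → Fin n → A (diagonal values are irrelevant/ignored).

record ZeroSumFlow (n k : ℕ) : Set where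
  field
    f       : Fin n → Fin n → ℤ
    symm    : ∀ i j → f i j ≡ f j i
    nonzero : ∀ i j → i ≢ j → f i j ≢ 0ℤ
    bounded : ∀ i j → i ≢ j → ∣ f i j ∣ < k
    zeroSum : ∀ v → sumFin n (λ u → when (¬? (u ≟ᶠ v)) (f v u)) ≡ 0ℤ

-- a 1-factorisation of K_n: a partition of E(K_n) into classes indexed by
-- Fin m (an edge colouring), each class being a perfect matching, i.e. every
-- vertex v is incident with exactly one edge of each class.
record OneFactorisation (n : ℕ) : Set where
  field
    m       : ℕ
    colour  : Fin n → Fin n → Fin m
    symm    : ∀ i j → colour i j ≡ colour j i
    perfect : ∀ (v : Fin n) (c : Fin m) →
              Σ (Fin n) λ u → (u ≢ v) × (colour v u ≡ c)
                × (∀ w → w ≢ v → colour v w ≡ c → w ≡ u)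

classWeight : ∀ {n} → (Fin n → Fin n → ℤ) → (F : OneFactorisation n) →
              Fin (OneFactorisation.m F) → ℤ
classWeight {n} f F c =
  sumFin n λ i → sumFin n λ j →
    when ((i <? j) ×-dec (OneFactorisation.colour F i j ≟ᶠ c)) (f i j)

record NullOneFactorisation (n k : ℕ) : Set where
  field
    flow        : ZeroSumFlow n k
    factors     : OneFactorisation n
    weightZero  : ∀ c → classWeight (ZeroSumFlow.f flow) factors c ≡ 0ℤ

-- K_(4t) is the blow-up of K_(2t) in which every vertex a becomes a pair {2a, 2a+1}, and a
-- 1-factorisation of K_(2t) lifts to one of K_(4t): one matching consists of the pairs, and every
-- base matching gives two matchings between pairs, joining equal and opposite positions respectively.
-- We lift the round-robin factorisation of K_(2t), relabelled so that its colour-0 matching is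
-- {2A, 2A+1}; this groups the vertices of K_(4t) into t blocks of four.
-- Between different blocks the flow satisfies f(a₀, b_e) = -f(a₁, b_¬e), so every matching lifted
-- from a base edge between blocks has weight zero.  Inside block A the pair edges carry ρ_A, the
-- parallel cross edges -ρ_A and the diagonals ±deg A, where ρ = 1, -1, 1, … (one -2 if t is odd)
-- sums to zero; this makes the three remaining matchings null.  Finally, a vertex of block A receives
-- the same ∓1 from each neighbouring block in the path 0 — 1 — ⋯ — (t-1) of blocks, and ±deg A from
-- inside its own block, so the flow is zero-sum.

module Submission where

open import Defs
open import Data.Nat using (ℕ)
open import Data.Nat.Divisibility using (_∣_)
open import Relation.Binary.PropositionalEquality using (_≢_)

open import Data.Nat.Divisibility using (divides)
open import Data.Bool using (Bool; true; false; not; _xor_; _∧_; if_then_else_)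
open import Data.Bool.Properties using (xor-comm; xor-assoc; xor-same; not-¬; ¬-not)
open import Data.Empty using (⊥-elim)
open import Data.Fin as Fin using (Fin; toℕ; fromℕ<)
import Data.Fin.Properties as Finₚ
open import Data.Integer as ℤ using (ℤ; 0ℤ; 1ℤ; -1ℤ; -_; _+_; ∣_∣)
import Data.Integer.Properties as ℤₚ
open import Data.Integer.Tactic.RingSolver using (solve-∀)
open import Data.Nat as ℕ using (zero; suc; _<_; _≤_; z≤n; s≤s; z<s; _∸_; _%_; ⌊_/2⌋)
open import Data.Nat.DivMod
  using (%-distribˡ-+; %-distribˡ-*; m%n%n≡m%n; n%n≡0; [m+n]%n≡m%n; [m+kn]%n≡m%n; m<n⇒m%n≡m; m%n<n)
import Data.Nat.Tactic.RingSolver as ℕ-Solver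
import Data.Nat.Properties as ℕₚ
open import Data.Product using (_×_; _,_; proj₁; proj₂)
open import Data.Sum using (_⊎_; inj₁; inj₂)
open import Function using (_∘_)
open import Relation.Nullary using (Dec; yes; no; does; ¬_)
open import Relation.Binary.Definitions using (tri<; tri≈; tri>)
open import Relation.Nullary.Decidable using (_×-dec_; ¬?; dec-true; dec-false)
open import Relation.Binary.PropositionalEquality
  using (_≡_; refl; sym; trans; cong; cong₂; subst; module ≡-Reasoning)

if-yes : ∀ {p} {P : Set p} {A : Set} (d : Dec P) {x y : A} → P → (if does d then x else y) ≡ x
if-yes (yes _) _  = refl
if-yes (no ¬p) p  = ⊥-elim (¬p p)

if-no : ∀ {p} {P : Set p} {A : Set} (d : Dec P) {x y : A} → ¬ P → (if does d then x else y) ≡ y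
if-no (yes p) ¬p = ⊥-elim (¬p p)
if-no (no _)  _  = refl

when≡if : ∀ {p} {P : Set p} (d : Dec P) x → when d x ≡ (if does d then x else 0ℤ)
when≡if (yes _) x = refl
when≡if (no _)  x = refl

module _ {a b} {A : Set a} {B : Set b} {x : ℤ} where

  when-×-no₁ : (A? : Dec A) (B? : Dec B) → ¬ A → when (A? ×-dec B?) x ≡ 0ℤ
  when-×-no₁ (yes a) _ ¬a = ⊥-elim (¬a a)
  when-×-no₁ (no _)  _ _  = refl

  when-×-no₂ : (A? : Dec A) (B? : Dec B) → ¬ B → when (A? ×-dec B?) x ≡ 0ℤ
  when-×-no₂ (yes _) (yes b) ¬b = ⊥-elim (¬b b)
  when-×-no₂ (yes _) (no _)  _  = refl
  when-×-no₂ (no _)  _       _  = refl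

  when-×-yes₂ : (A? : Dec A) (B? : Dec B) → B → when (A? ×-dec B?) x ≡ when A? x
  when-×-yes₂ (yes _) (yes _)  _ = refl
  when-×-yes₂ (yes _) (no ¬b)  b = ⊥-elim (¬b b)
  when-×-yes₂ (no _)  _        _ = refl

infixl 7 _·2+_

_·2+_ : ℕ → Bool → ℕ
zero  ·2+ false = 0
zero  ·2+ true  = 1
suc a ·2+ s     = suc (suc (a ·2+ s))

odd : ℕ → Bool
odd zero          = false
odd (suc zero)    = true
odd (suc (suc n)) = odd n

⌊·2+/2⌋ : ∀ a s → ⌊ a ·2+ s /2⌋ ≡ a
⌊·2+/2⌋ zero    false = refl
⌊·2+/2⌋ zero    true  = refl
⌊·2+/2⌋ (suc a) s     = cong suc (⌊·2+/2⌋ a s)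

odd-·2+ : ∀ a s → odd (a ·2+ s) ≡ s
odd-·2+ zero    false = refl
odd-·2+ zero    true  = refl
odd-·2+ (suc a) s     = odd-·2+ a s

⌊/2⌋·2+odd : ∀ v → ⌊ v /2⌋ ·2+ odd v ≡ v
⌊/2⌋·2+odd zero          = refl
⌊/2⌋·2+odd (suc zero)    = refl
⌊/2⌋·2+odd (suc (suc v)) = cong (suc ∘ suc) (⌊/2⌋·2+odd v)

⌊/2⌋-odd-injective : ∀ {v w} → ⌊ v /2⌋ ≡ ⌊ w /2⌋ → odd v ≡ odd w → v ≡ w
⌊/2⌋-odd-injective {v} {w} p q =
  trans (sym (⌊/2⌋·2+odd v)) (trans (cong₂ _·2+_ p q) (⌊/2⌋·2+odd w))

xor-cancelˡ : ∀ a b → a xor (a xor b) ≡ b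
xor-cancelˡ a b = trans (sym (xor-assoc a a b)) (cong (_xor b) (xor-same a))

·2+-not-≢ : ∀ a s → a ·2+ not s ≢ a ·2+ s
·2+-not-≢ a s eq = not-¬ refl (sym (trans (sym (odd-·2+ a (not s))) (trans (cong odd eq) (odd-·2+ a s))))

·2+-false<true : ∀ a → a ·2+ false < a ·2+ true
·2+-false<true zero    = z<s
·2+-false<true (suc a) = s≤s (s≤s (·2+-false<true a))

·2+-< : ∀ {a k} s → a < k → a ·2+ s < k ℕ.* 2
·2+-< {zero}  {suc k} false _         = s≤s z≤n
·2+-< {zero}  {suc k} true  _         = s≤s (s≤s z≤n)
·2+-< {suc a} {suc k} s     (s≤s a<k) = s≤s (s≤s (·2+-< s a<k))

·2+-mono-< : ∀ {a b} s s′ → a < b → a ·2+ s < b ·2+ s′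
·2+-mono-< {a} {b} s s′ a<b = ℕₚ.<-≤-trans (·2+-< s a<b) (lower b)
  where
  lower : ∀ b → b ℕ.* 2 ≤ b ·2+ s′
  lower zero    = z≤n
  lower (suc b) = s≤s (s≤s (lower b))

does-<?-·2+ : ∀ {a b} s s′ → a ≢ b → does (a ·2+ s ℕₚ.<? b ·2+ s′) ≡ does (a ℕₚ.<? b)
does-<?-·2+ {a} {b} s s′ a≢b with ℕₚ.<-cmp a b
... | tri< a<b _ _ = trans (dec-true (a ·2+ s ℕₚ.<? b ·2+ s′) (·2+-mono-< s s′ a<b)) (sym (dec-true (a ℕₚ.<? b) a<b))
... | tri≈ _ a≡b _ = ⊥-elim (a≢b a≡b)
... | tri> _ _ b<a = trans (dec-false (a ·2+ s ℕₚ.<? b ·2+ s′) (ℕₚ.<⇒≯ (·2+-mono-< s′ s b<a)))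
                           (sym (dec-false (a ℕₚ.<? b) (ℕₚ.<⇒≯ b<a)))

⌊/2⌋-< : ∀ {v k} → v < k ℕ.* 2 → ⌊ v /2⌋ < k
⌊/2⌋-< {zero}        {suc k} _                 = s≤s z≤n
⌊/2⌋-< {suc zero}    {suc k} _                 = s≤s z≤n
⌊/2⌋-< {suc (suc v)} {suc k} (s≤s (s≤s v<2k)) = s≤s (⌊/2⌋-< v<2k)

sumFin-cong : ∀ n {g h : Fin n → ℤ} → (∀ i → g i ≡ h i) → sumFin n g ≡ sumFin n h
sumFin-cong zero    eq = refl
sumFin-cong (suc n) eq = cong₂ _+_ (eq Fin.zero) (sumFin-cong n (eq ∘ Fin.suc))

sumFin-zero : ∀ n {g : Fin n → ℤ} → (∀ i → g i ≡ 0ℤ) → sumFin n g ≡ 0ℤ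
sumFin-zero zero    eq = refl
sumFin-zero (suc n) eq = cong₂ _+_ (eq Fin.zero) (sumFin-zero n (eq ∘ Fin.suc))

sumFin-single : ∀ n {g : Fin n → ℤ} k → (∀ j → j ≢ k → g j ≡ 0ℤ) → sumFin n g ≡ g k
sumFin-single (suc n) {g} Fin.zero vanish =
  trans (cong (g Fin.zero +_) (sumFin-zero n (λ j → vanish (Fin.suc j) (λ ())))) (ℤₚ.+-identityʳ _)
sumFin-single (suc n) {g} (Fin.suc k) vanish =
  trans (cong (_+ sumFin n (g ∘ Fin.suc)) (vanish Fin.zero (λ ())))
        (trans (ℤₚ.+-identityˡ _) (sumFin-single n k (λ j j≢k → vanish (Fin.suc j) (j≢k ∘ Finₚ.suc-injective))))

∑< : ℕ → (ℕ → ℤ) → ℤ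
∑< n g = sumFin n (g ∘ toℕ)

∑<-cong : ∀ n {g h : ℕ → ℤ} → (∀ k → k < n → g k ≡ h k) → ∑< n g ≡ ∑< n h
∑<-cong n eq = sumFin-cong n (λ i → eq (toℕ i) (Finₚ.toℕ<n i))

∑<-zero : ∀ n {g : ℕ → ℤ} → (∀ k → k < n → g k ≡ 0ℤ) → ∑< n g ≡ 0ℤ
∑<-zero n eq = sumFin-zero n (λ i → eq (toℕ i) (Finₚ.toℕ<n i))

∑<-distrib-+ : ∀ n (g h : ℕ → ℤ) → ∑< n (λ k → g k + h k) ≡ ∑< n g + ∑< n h
∑<-distrib-+ zero    g h = refl
∑<-distrib-+ (suc n) g h =
  trans (cong ((g 0 + h 0) +_) (∑<-distrib-+ n (g ∘ suc) (h ∘ suc)))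
        (interchange (g 0) (h 0) (∑< n (g ∘ suc)) (∑< n (h ∘ suc)))
  where
  interchange : ∀ a b c d → a + b + (c + d) ≡ a + c + (b + d)
  interchange = solve-∀

∑<-neg : ∀ n (g : ℕ → ℤ) → ∑< n (λ k → - g k) ≡ - ∑< n g
∑<-neg zero    g = refl
∑<-neg (suc n) g = trans (cong (- g 0 +_) (∑<-neg n (g ∘ suc))) (sym (ℤₚ.neg-distrib-+ (g 0) _))

∑<-*2 : ∀ n (g : ℕ → ℤ) → ∑< (n ℕ.* 2) g ≡ ∑< n (λ a → g (a ·2+ false) + g (a ·2+ true))
∑<-*2 zero    g = refl
∑<-*2 (suc n) g =
  trans (cong (g 0 +_) (cong (g 1 +_) (∑<-*2 n (g ∘ suc ∘ suc))))
        (sym (ℤₚ.+-assoc (g 0) (g 1) _))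

quad : (Bool → Bool → ℤ) → ℤ
quad h = (h false false + h false true) + (h true false + h true true)

quad-cong : ∀ {h h′ : Bool → Bool → ℤ} → (∀ j s → h j s ≡ h′ j s) → quad h ≡ quad h′
quad-cong eq = cong₂ _+_ (cong₂ _+_ (eq false false) (eq false true)) (cong₂ _+_ (eq true false) (eq true true))

∑<-quad : ∀ n (g : ℕ → ℤ) → ∑< (n ℕ.* 2 ℕ.* 2) g ≡ ∑< n (λ B → quad (λ j s → g (B ·2+ j ·2+ s)))
∑<-quad n g = trans (∑<-*2 (n ℕ.* 2) g) (∑<-*2 n (λ a → g (a ·2+ false) + g (a ·2+ true)))

∑<-single : ∀ n {g : ℕ → ℤ} k → (∀ j → j ≢ k → g j ≡ 0ℤ) → ∑< n g ≡ (if does (k ℕₚ.<? n) then g k else 0ℤ)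
∑<-single zero    k       vanish = refl
∑<-single (suc n) {g} zero    vanish =
  trans (cong (g 0 +_) (∑<-zero n (λ j _ → vanish (suc j) (λ ())))) (ℤₚ.+-identityʳ (g 0))
∑<-single (suc n) {g} (suc k) vanish =
  trans (cong (_+ ∑< n (g ∘ suc)) (vanish 0 (λ ())))
        (trans (ℤₚ.+-identityˡ _) (∑<-single n k (λ j j≢k → vanish (suc j) (j≢k ∘ ℕₚ.suc-injective))))

module _ {n} (F : OneFactorisation n) where
  open OneFactorisation F

  partnerIn : Fin m → Fin n → Fin n
  partnerIn c v = proj₁ (perfect v c)

  classWeight≡∑partner : ∀ (f : Fin n → Fin n → ℤ) c →
    classWeight f F c ≡ sumFin n (λ v → when (v Finₚ.<? partnerIn c v) (f v (partnerIn c v)))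
  classWeight≡∑partner f c = sumFin-cong n λ v →
    let (p , p≢v , colour≡c , unique) = perfect v c in
    trans (sumFin-single n p (offPartner v p unique))
          (when-×-yes₂ (v Finₚ.<? p) (colour v p Finₚ.≟ c) colour≡c)
    where
    offPartner : ∀ v p → (∀ w → w ≢ v → colour v w ≡ c → w ≡ p) → ∀ w → w ≢ p →
                 when ((v Finₚ.<? w) ×-dec (colour v w Finₚ.≟ c)) (f v w) ≡ 0ℤ
    offPartner v p unique w w≢p with w Finₚ.≟ v
    ... | yes refl = when-×-no₁ (w Finₚ.<? w) (colour w w Finₚ.≟ c) (Finₚ.<-irrefl refl)
    ... | no  w≢v  = when-×-no₂ (v Finₚ.<? w) (colour v w Finₚ.≟ c) (w≢p ∘ unique w w≢v)

-- K_k on the vertices 0, …, k-1 split into the perfect matchings 0, …, c-1;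
-- partner γ a is the neighbour of a in the matching γ.
record Factorisation (k c : ℕ) : Set where
  field
    colour         : ℕ → ℕ → ℕ
    partner        : ℕ → ℕ → ℕ
    colour-sym     : ∀ a b → colour a b ≡ colour b a
    colour-<       : ∀ {a b} → a < k → b < k → colour a b < c
    partner-<      : ∀ {γ a} → γ < c → a < k → partner γ a < k
    partner-≢      : ∀ {γ a} → γ < c → a < k → partner γ a ≢ a
    colour-partner : ∀ {γ a} → γ < c → a < k → colour a (partner γ a) ≡ γ
    partner-unique : ∀ {γ a b} → γ < c → a < k → b < k → b ≢ a → colour a b ≡ γ → b ≡ partner γ a

fromSmaller : (ℕ → ℕ → ℤ) → ℕ → ℕ → ℤ
fromSmaller f v u = if does (v ℕₚ.<? u) then f v u else 0ℤ

matchingWeight : ℕ → (ℕ → ℕ → ℤ) → (ℕ → ℕ) → ℤ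
matchingWeight n f p = ∑< n (λ v → fromSmaller f v (p v))

module _ {n m} (R : Factorisation n m) where
  open Factorisation R

  private
    finColour : Fin n → Fin n → Fin m
    finColour i j = fromℕ< (colour-< (Finₚ.toℕ<n i) (Finₚ.toℕ<n j))

    toℕ-finColour : ∀ i j → toℕ (finColour i j) ≡ colour (toℕ i) (toℕ j)
    toℕ-finColour i j = Finₚ.toℕ-fromℕ< _

    finPartner : Fin m → Fin n → Fin n
    finPartner c v = fromℕ< (partner-< (Finₚ.toℕ<n c) (Finₚ.toℕ<n v))

    toℕ-finPartner : ∀ c v → toℕ (finPartner c v) ≡ partner (toℕ c) (toℕ v)
    toℕ-finPartner c v = Finₚ.toℕ-fromℕ< _

    γ<m : ∀ (c : Fin m) → toℕ c < m
    γ<m = Finₚ.toℕ<n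

  toOneFactorisation : OneFactorisation n
  toOneFactorisation = record
    { m       = m
    ; colour  = finColour
    ; symm    = λ i j → Finₚ.toℕ-injective (begin
        toℕ (finColour i j)      ≡⟨ toℕ-finColour i j ⟩
        colour (toℕ i) (toℕ j)  ≡⟨ colour-sym (toℕ i) (toℕ j) ⟩
        colour (toℕ j) (toℕ i)  ≡⟨ toℕ-finColour j i ⟨
        toℕ (finColour j i)      ∎)
    ; perfect = λ v c → finPartner c v , partner≢ v c , colour≡c v c , unique v c
    }
    where
    open ≡-Reasoning
    v<n = Finₚ.toℕ<n

    partner≢ : ∀ v c → finPartner c v ≢ v
    partner≢ v c eq = partner-≢ (γ<m c) (v<n v) (trans (sym (toℕ-finPartner c v)) (cong toℕ eq))

    colour≡c : ∀ v c → finColour v (finPartner c v) ≡ c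
    colour≡c v c = Finₚ.toℕ-injective (begin
      toℕ (finColour v (finPartner c v))        ≡⟨ toℕ-finColour v (finPartner c v) ⟩
      colour (toℕ v) (toℕ (finPartner c v))    ≡⟨ cong (colour (toℕ v)) (toℕ-finPartner c v) ⟩
      colour (toℕ v) (partner (toℕ c) (toℕ v)) ≡⟨ colour-partner (γ<m c) (v<n v) ⟩
      toℕ c                                     ∎)

    unique : ∀ v c w → w ≢ v → finColour v w ≡ c → w ≡ finPartner c v
    unique v c w w≢v eq = Finₚ.toℕ-injective (begin
      toℕ w                     ≡⟨ partner-unique (γ<m c) (v<n v) (v<n w) (w≢v ∘ Finₚ.toℕ-injective)
                                     (trans (sym (toℕ-finColour v w)) (cong toℕ eq)) ⟩
      partner (toℕ c) (toℕ v)  ≡⟨ toℕ-finPartner c v ⟨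
      toℕ (finPartner c v)      ∎)

  classWeight≡matchingWeight : ∀ (f : ℕ → ℕ → ℤ) c →
    classWeight (λ i j → f (toℕ i) (toℕ j)) toOneFactorisation c ≡ matchingWeight n f (partner (toℕ c))
  classWeight≡matchingWeight f c =
    trans (classWeight≡∑partner toOneFactorisation _ c)
          (sumFin-cong n λ v → trans (when≡if (v Finₚ.<? finPartner c v) _) (reindex v (toℕ-finPartner c v)))
    where
    reindex : ∀ v {k} → toℕ (finPartner c v) ≡ k →
      (if does (v Finₚ.<? finPartner c v) then f (toℕ v) (toℕ (finPartner c v)) else 0ℤ) ≡ fromSmaller f (toℕ v) k
    reindex v refl = refl

sumFin-offDiagonal : ∀ n (v : Fin n) (g : Fin n → ℤ) → g v ≡ 0ℤ →
                     sumFin n (λ u → when (¬? (u Finₚ.≟ v)) (g u)) ≡ sumFin n g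
sumFin-offDiagonal n v g gv≡0 = sumFin-cong n offDiagonal
  where
  offDiagonal : ∀ u → when (¬? (u Finₚ.≟ v)) (g u) ≡ g u
  offDiagonal u with u Finₚ.≟ v
  ... | yes refl = sym gv≡0
  ... | no  _    = refl

toZeroSumFlow : ∀ {n k} (f : ℕ → ℕ → ℤ) →
  (∀ v u → f v u ≡ f u v) →
  (∀ v → f v v ≡ 0ℤ) →
  (∀ {v u} → v < n → u < n → v ≢ u → f v u ≢ 0ℤ × ∣ f v u ∣ < k) →
  (∀ {v} → v < n → ∑< n (f v) ≡ 0ℤ) →
  ZeroSumFlow n k
toZeroSumFlow {n} {k} f symm diagonal values balanced = record
  { f       = λ i j → f (toℕ i) (toℕ j)
  ; symm    = λ i j → symm (toℕ i) (toℕ j)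
  ; nonzero = λ i j i≢j → proj₁ (value i j i≢j)
  ; bounded = λ i j i≢j → proj₂ (value i j i≢j)
  ; zeroSum = λ v → trans (sumFin-offDiagonal n v _ (diagonal (toℕ v))) (balanced (Finₚ.toℕ<n v))
  }
  where
  value : ∀ i j → i ≢ j → f (toℕ i) (toℕ j) ≢ 0ℤ × ∣ f (toℕ i) (toℕ j) ∣ < k
  value i j i≢j = values (Finₚ.toℕ<n i) (Finₚ.toℕ<n j) (i≢j ∘ Finₚ.toℕ-injective)

relabel : ∀ {k c} → Factorisation k c → (σ τ : ℕ → ℕ) →
  (∀ {a} → a < k → σ a < k) → (∀ {a} → a < k → τ a < k) →
  (∀ {a} → a < k → τ (σ a) ≡ a) → (∀ {a} → a < k → σ (τ a) ≡ a) →
  Factorisation k c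
relabel {k} R σ τ σ-< τ-< τσ≡id στ≡id = record
  { colour         = λ a b → colour (σ a) (σ b)
  ; partner        = λ γ a → τ (partner γ (σ a))
  ; colour-sym     = λ a b → colour-sym (σ a) (σ b)
  ; colour-<       = λ a<k b<k → colour-< (σ-< a<k) (σ-< b<k)
  ; partner-<      = λ γ<c a<k → τ-< (partner-< γ<c (σ-< a<k))
  ; partner-≢      = λ γ<c a<k eq →
      partner-≢ γ<c (σ-< a<k) (trans (sym (στ≡id (partner-< γ<c (σ-< a<k)))) (cong σ eq))
  ; colour-partner = λ {γ} {a} γ<c a<k →
      trans (cong (colour (σ a)) (στ≡id (partner-< γ<c (σ-< a<k)))) (colour-partner γ<c (σ-< a<k))
  ; partner-unique = λ γ<c a<k b<k b≢a eq →
      trans (sym (τσ≡id b<k)) (cong τ (partner-unique γ<c (σ-< a<k) (σ-< b<k) (b≢a ∘ σ-injective b<k a<k) eq))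
  }
  where
  open Factorisation R
  σ-injective : ∀ {a b} → a < k → b < k → σ a ≡ σ b → a ≡ b
  σ-injective a<k b<k eq = trans (sym (τσ≡id a<k)) (trans (cong τ eq) (τσ≡id b<k))

-- The round-robin 1-factorisation of K_(q+1) for odd q = 2T+1, the vertex q playing the point at
-- infinity: {x, y} gets colour x + y and {x, ∞} gets colour 2x, modulo q.
module RoundRobin (T : ℕ) where

  q : ℕ
  q = suc (T ℕ.* 2)

  minus : ℕ → ℕ → ℕ
  minus x γ = (γ ℕ.+ (q ∸ x)) % q

  -- since 2 (T + 1) = q + 1, multiplying by T + 1 halves modulo q
  halve : ℕ → ℕ
  halve γ = (γ ℕ.* suc T) % q

  colour : ℕ → ℕ → ℕ
  colour x y = if does (x ℕₚ.≟ q) then (y ℕ.+ y) % q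
               else if does (y ℕₚ.≟ q) then (x ℕ.+ x) % q
               else (x ℕ.+ y) % q

  partner : ℕ → ℕ → ℕ
  partner γ x = if does (x ℕₚ.≟ q) then halve γ
                else if does (minus x γ ℕₚ.≟ x) then q
                else minus x γ

  %-+ˡ : ∀ a b → (a % q ℕ.+ b) % q ≡ (a ℕ.+ b) % q
  %-+ˡ a b = begin
    (a % q ℕ.+ b) % q           ≡⟨ %-distribˡ-+ (a % q) b q ⟩
    (a % q % q ℕ.+ b % q) % q   ≡⟨ cong (λ z → (z ℕ.+ b % q) % q) (m%n%n≡m%n a q) ⟩
    (a % q ℕ.+ b % q) % q       ≡⟨ %-distribˡ-+ a b q ⟨
    (a ℕ.+ b) % q               ∎
    where open ≡-Reasoning

  %-*ˡ : ∀ a b → (a % q ℕ.* b) % q ≡ (a ℕ.* b) % q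
  %-*ˡ a b = begin
    (a % q ℕ.* b) % q           ≡⟨ %-distribˡ-* (a % q) b q ⟩
    (a % q % q ℕ.* (b % q)) % q ≡⟨ cong (λ z → (z ℕ.* (b % q)) % q) (m%n%n≡m%n a q) ⟩
    (a % q ℕ.* (b % q)) % q     ≡⟨ %-distribˡ-* a b q ⟨
    (a ℕ.* b) % q               ∎
    where open ≡-Reasoning

  +-minus : ∀ {x γ} → x < q → γ < q → (x ℕ.+ minus x γ) % q ≡ γ
  +-minus {x} {γ} x<q γ<q = begin
    (x ℕ.+ minus x γ) % q        ≡⟨ cong (_% q) (ℕₚ.+-comm x (minus x γ)) ⟩
    (minus x γ ℕ.+ x) % q        ≡⟨ %-+ˡ (γ ℕ.+ (q ∸ x)) x ⟩
    (γ ℕ.+ (q ∸ x) ℕ.+ x) % q    ≡⟨ cong (_% q) (ℕₚ.+-assoc γ (q ∸ x) x) ⟩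
    (γ ℕ.+ ((q ∸ x) ℕ.+ x)) % q  ≡⟨ cong (λ z → (γ ℕ.+ z) % q) (ℕₚ.m∸n+n≡m (ℕₚ.<⇒≤ x<q)) ⟩
    (γ ℕ.+ q) % q                ≡⟨ [m+n]%n≡m%n γ q ⟩
    γ % q                        ≡⟨ m<n⇒m%n≡m γ<q ⟩
    γ                            ∎
    where open ≡-Reasoning

  minus-unique : ∀ {x y γ} → x < q → y < q → (x ℕ.+ y) % q ≡ γ → y ≡ minus x γ
  minus-unique {x} {y} {γ} x<q y<q x+y≡γ = sym (begin
    (γ ℕ.+ (q ∸ x)) % q               ≡⟨ cong (λ z → (z ℕ.+ (q ∸ x)) % q) x+y≡γ ⟨
    ((x ℕ.+ y) % q ℕ.+ (q ∸ x)) % q   ≡⟨ %-+ˡ (x ℕ.+ y) (q ∸ x) ⟩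
    (x ℕ.+ y ℕ.+ (q ∸ x)) % q         ≡⟨ cong (_% q) (ℕₚ.+-comm (x ℕ.+ y) (q ∸ x)) ⟩
    ((q ∸ x) ℕ.+ (x ℕ.+ y)) % q       ≡⟨ cong (_% q) (ℕₚ.+-assoc (q ∸ x) x y) ⟨
    ((q ∸ x) ℕ.+ x ℕ.+ y) % q         ≡⟨ cong (λ z → (z ℕ.+ y) % q) (ℕₚ.m∸n+n≡m (ℕₚ.<⇒≤ x<q)) ⟩
    (q ℕ.+ y) % q                     ≡⟨ cong (_% q) (ℕₚ.+-comm q y) ⟩
    (y ℕ.+ q) % q                     ≡⟨ [m+n]%n≡m%n y q ⟩
    y % q                             ≡⟨ m<n⇒m%n≡m y<q ⟩
    y                                 ∎)
    where open ≡-Reasoning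

  halve-+ : ∀ {γ} → γ < q → (halve γ ℕ.+ halve γ) % q ≡ γ
  halve-+ {γ} γ<q = begin
    (halve γ ℕ.+ halve γ) % q     ≡⟨ cong (_% q) (double≡*2 (halve γ)) ⟩
    (halve γ ℕ.* 2) % q           ≡⟨ %-*ˡ (γ ℕ.* suc T) 2 ⟩
    (γ ℕ.* suc T ℕ.* 2) % q       ≡⟨ cong (_% q) (arithmetic T γ) ⟩
    (γ ℕ.+ γ ℕ.* q) % q           ≡⟨ [m+kn]%n≡m%n γ γ q ⟩
    γ % q                         ≡⟨ m<n⇒m%n≡m γ<q ⟩
    γ                             ∎
    where
    open ≡-Reasoning
    double≡*2 : ∀ x → x ℕ.+ x ≡ x ℕ.* 2
    double≡*2 = ℕ-Solver.solve-∀
    arithmetic : ∀ T γ → γ ℕ.* suc T ℕ.* 2 ≡ γ ℕ.+ γ ℕ.* suc (T ℕ.* 2)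
    arithmetic = ℕ-Solver.solve-∀

  halve-unique : ∀ {x γ} → x < q → (x ℕ.+ x) % q ≡ γ → x ≡ halve γ
  halve-unique {x} {γ} x<q x+x≡γ = sym (begin
    (γ ℕ.* suc T) % q                ≡⟨ cong (λ z → (z ℕ.* suc T) % q) x+x≡γ ⟨
    ((x ℕ.+ x) % q ℕ.* suc T) % q    ≡⟨ %-*ˡ (x ℕ.+ x) (suc T) ⟩
    ((x ℕ.+ x) ℕ.* suc T) % q        ≡⟨ cong (_% q) (arithmetic T x) ⟩
    (x ℕ.+ x ℕ.* q) % q              ≡⟨ [m+kn]%n≡m%n x x q ⟩
    x % q                            ≡⟨ m<n⇒m%n≡m x<q ⟩
    x                                ∎)
    where
    open ≡-Reasoning
    arithmetic : ∀ T x → (x ℕ.+ x) ℕ.* suc T ≡ x ℕ.+ x ℕ.* suc (T ℕ.* 2)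
    arithmetic = ℕ-Solver.solve-∀

  colour-∞ˡ : ∀ y → colour q y ≡ (y ℕ.+ y) % q
  colour-∞ˡ y = if-yes (q ℕₚ.≟ q) refl

  colour-∞ʳ : ∀ {x} → x ≢ q → colour x q ≡ (x ℕ.+ x) % q
  colour-∞ʳ {x} x≢q = trans (if-no (x ℕₚ.≟ q) x≢q) (if-yes (q ℕₚ.≟ q) refl)

  colour-finite : ∀ {x y} → x ≢ q → y ≢ q → colour x y ≡ (x ℕ.+ y) % q
  colour-finite {x} {y} x≢q y≢q = trans (if-no (x ℕₚ.≟ q) x≢q) (if-no (y ℕₚ.≟ q) y≢q)

  partner-∞ : ∀ γ → partner γ q ≡ halve γ
  partner-∞ γ = if-yes (q ℕₚ.≟ q) refl

  partner-fixed : ∀ γ {x} → x ≢ q → minus x γ ≡ x → partner γ x ≡ q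
  partner-fixed γ {x} x≢q fixed = trans (if-no (x ℕₚ.≟ q) x≢q) (if-yes (minus x γ ℕₚ.≟ x) fixed)

  partner-finite : ∀ γ {x} → x ≢ q → minus x γ ≢ x → partner γ x ≡ minus x γ
  partner-finite γ {x} x≢q moved = trans (if-no (x ℕₚ.≟ q) x≢q) (if-no (minus x γ ℕₚ.≟ x) moved)

  %q≢q : ∀ a → a % q ≢ q
  %q≢q a = ℕₚ.<⇒≢ (m%n<n a q)

  finite : ∀ {x} → x < suc q → x ≢ q → x < q
  finite x<1+q x≢q = ℕₚ.≤∧≢⇒< (ℕₚ.≤-pred x<1+q) x≢q

  roundRobin : Factorisation (suc q) q
  roundRobin = record
    { colour         = colour
    ; partner        = partner
    ; colour-sym     = colour-sym
    ; colour-<       = λ {x} {y} _ _ → colour-< x y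
    ; partner-<      = λ {γ} {x} _ _ → partner-< γ x
    ; partner-≢      = λ {γ} {x} _ _ → partner-≢ γ x
    ; colour-partner = colour-partner
    ; partner-unique = partner-unique
    }
    where
    colour-sym : ∀ x y → colour x y ≡ colour y x
    colour-sym x y with x ℕₚ.≟ q | y ℕₚ.≟ q
    ... | yes refl | yes refl = refl
    ... | yes refl | no y≢q   = trans (colour-∞ˡ y) (sym (colour-∞ʳ y≢q))
    ... | no x≢q   | yes refl = trans (colour-∞ʳ x≢q) (sym (colour-∞ˡ x))
    ... | no x≢q   | no y≢q   =
      trans (colour-finite x≢q y≢q) (trans (cong (_% q) (ℕₚ.+-comm x y)) (sym (colour-finite y≢q x≢q)))

    colour-< : ∀ x y → colour x y < q
    colour-< x y with x ℕₚ.≟ q | y ℕₚ.≟ q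
    ... | yes refl | _        = subst (_< q) (sym (colour-∞ˡ y)) (m%n<n (y ℕ.+ y) q)
    ... | no x≢q   | yes refl = subst (_< q) (sym (colour-∞ʳ x≢q)) (m%n<n (x ℕ.+ x) q)
    ... | no x≢q   | no y≢q   = subst (_< q) (sym (colour-finite x≢q y≢q)) (m%n<n (x ℕ.+ y) q)

    partner-< : ∀ γ x → partner γ x < suc q
    partner-< γ x with x ℕₚ.≟ q
    ... | yes refl = subst (_< suc q) (sym (partner-∞ γ)) (ℕₚ.m<n⇒m<1+n (m%n<n (γ ℕ.* suc T) q))
    ... | no x≢q with minus x γ ℕₚ.≟ x
    ...   | yes fixed = subst (_< suc q) (sym (partner-fixed γ x≢q fixed)) (ℕₚ.n<1+n q)
    ...   | no moved  = subst (_< suc q) (sym (partner-finite γ x≢q moved)) (ℕₚ.m<n⇒m<1+n (m%n<n (γ ℕ.+ (q ∸ x)) q))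

    partner-≢ : ∀ γ x → partner γ x ≢ x
    partner-≢ γ x with x ℕₚ.≟ q
    ... | yes refl = %q≢q (γ ℕ.* suc T) ∘ trans (sym (partner-∞ γ))
    ... | no x≢q with minus x γ ℕₚ.≟ x
    ...   | yes fixed = x≢q ∘ sym ∘ trans (sym (partner-fixed γ x≢q fixed))
    ...   | no moved  = moved ∘ trans (sym (partner-finite γ x≢q moved))

    colour-partner : ∀ {γ x} → γ < q → x < suc q → colour x (partner γ x) ≡ γ
    colour-partner {γ} {x} γ<q x<1+q with x ℕₚ.≟ q
    ... | yes refl = trans (cong (colour q) (partner-∞ γ)) (trans (colour-∞ˡ (halve γ)) (halve-+ γ<q))
    ... | no x≢q with minus x γ ℕₚ.≟ x
    ...   | yes fixed = begin
      colour x (partner γ x)    ≡⟨ cong (colour x) (partner-fixed γ x≢q fixed) ⟩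
      colour x q                ≡⟨ colour-∞ʳ x≢q ⟩
      (x ℕ.+ x) % q             ≡⟨ cong (λ z → (x ℕ.+ z) % q) fixed ⟨
      (x ℕ.+ minus x γ) % q     ≡⟨ +-minus (finite x<1+q x≢q) γ<q ⟩
      γ                         ∎
      where open ≡-Reasoning
    ...   | no moved = begin
      colour x (partner γ x)    ≡⟨ cong (colour x) (partner-finite γ x≢q moved) ⟩
      colour x (minus x γ)      ≡⟨ colour-finite x≢q (%q≢q (γ ℕ.+ (q ∸ x))) ⟩
      (x ℕ.+ minus x γ) % q     ≡⟨ +-minus (finite x<1+q x≢q) γ<q ⟩
      γ                         ∎
      where open ≡-Reasoning

    colour-solution : ∀ {γ x y} → x < suc q → y < suc q → x ≢ q → y ≢ q → colour x y ≡ γ → y ≡ minus x γ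
    colour-solution x<1+q y<1+q x≢q y≢q xy≡γ =
      minus-unique (finite x<1+q x≢q) (finite y<1+q y≢q) (trans (sym (colour-finite x≢q y≢q)) xy≡γ)

    partner-unique : ∀ {γ x y} → γ < q → x < suc q → y < suc q → y ≢ x → colour x y ≡ γ → y ≡ partner γ x
    partner-unique {γ} {x} {y} γ<q x<1+q y<1+q y≢x xy≡γ with x ℕₚ.≟ q
    ... | yes refl = trans (halve-unique (finite y<1+q y≢x) (trans (sym (colour-∞ˡ y)) xy≡γ)) (sym (partner-∞ γ))
    ... | no x≢q with minus x γ ℕₚ.≟ x | y ℕₚ.≟ q
    ...   | yes fixed | yes refl = sym (partner-fixed γ x≢q fixed)
    ...   | yes fixed | no y≢q   = ⊥-elim (y≢x (trans (colour-solution x<1+q y<1+q x≢q y≢q xy≡γ) fixed))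
    ...   | no moved  | yes refl = ⊥-elim (moved (sym (minus-unique x<q x<q (trans (sym (colour-∞ʳ x≢q)) xy≡γ))))
      where x<q = finite x<1+q x≢q
    ...   | no moved  | no y≢q   =
      trans (colour-solution x<1+q y<1+q x≢q y≢q xy≡γ) (sym (partner-finite γ x≢q moved))

  -- Relabel the vertices so that the colour-0 class is {{2A, 2A+1} : A ≤ T}:
  -- 2A ↦ A, 1 ↦ ∞ and 2A+1 ↦ q - A (A ≥ 1) is a bijection {0, …, 2T+1} → {0, …, q}.
  label : ℕ → Bool → ℕ
  label A       false = A
  label zero    true  = q
  label (suc A) true  = q ∸ suc A

  toPoint : ℕ → ℕ
  toPoint a = label ⌊ a /2⌋ (odd a)

  fromPoint : ℕ → ℕ
  fromPoint y = if does (y ℕₚ.<? suc T) then y ·2+ false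
                else if does (y ℕₚ.≟ q) then zero ·2+ true
                else (q ∸ y) ·2+ true

  toPoint-·2+ : ∀ A s → toPoint (A ·2+ s) ≡ label A s
  toPoint-·2+ A s = cong₂ label (⌊·2+/2⌋ A s) (odd-·2+ A s)

  T<q : T < q
  T<q = s≤s (ℕₚ.m≤m*n T 2)

  q∸1+T≡T : q ∸ suc T ≡ T
  q∸1+T≡T = trans (cong (_∸ T) (*2≡+ T)) (ℕₚ.m+n∸n≡m T T)
    where
    *2≡+ : ∀ T → T ℕ.* 2 ≡ T ℕ.+ T
    *2≡+ = ℕ-Solver.solve-∀

  q∸T≡1+T : q ∸ T ≡ suc T
  q∸T≡1+T = trans (ℕₚ.+-∸-assoc 1 (ℕₚ.m≤m*n T 2)) (cong suc q∸1+T≡T)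

  q∸-≥ : ∀ {A} → suc A < suc T → suc T ≤ q ∸ suc A
  q∸-≥ {A} (s≤s A<T) = subst (_≤ q ∸ suc A) q∸T≡1+T (ℕₚ.∸-monoʳ-≤ q A<T)

  q∸-< : ∀ {y} → suc T ≤ y → q ∸ y < suc T
  q∸-< {y} T<y = s≤s (subst (q ∸ y ≤_) q∸1+T≡T (ℕₚ.∸-monoʳ-≤ q T<y))

  label-< : ∀ {A} → A < suc T → ∀ s → label A s < suc q
  label-< A<1+T     false = ℕₚ.m<n⇒m<1+n (ℕₚ.<-≤-trans A<1+T T<q)
  label-< {zero}  _ true  = ℕₚ.n<1+n q
  label-< {suc A} _ true  = s≤s (ℕₚ.m∸n≤m q (suc A))

  label-true : ∀ {A} → A ≢ 0 → label A true ≡ q ∸ A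
  label-true {zero}  A≢0 = ⊥-elim (A≢0 refl)
  label-true {suc A} _   = refl

  fromPoint-small : ∀ {y} → y < suc T → fromPoint y ≡ y ·2+ false
  fromPoint-small {y} = if-yes (y ℕₚ.<? suc T)

  fromPoint-∞ : fromPoint q ≡ 0 ·2+ true
  fromPoint-∞ = trans (if-no (q ℕₚ.<? suc T) (ℕₚ.≤⇒≯ T<q)) (if-yes (q ℕₚ.≟ q) refl)

  fromPoint-large : ∀ {y} → suc T ≤ y → y ≢ q → fromPoint y ≡ (q ∸ y) ·2+ true
  fromPoint-large {y} T<y y≢q = trans (if-no (y ℕₚ.<? suc T) (ℕₚ.≤⇒≯ T<y)) (if-no (y ℕₚ.≟ q) y≢q)

  fromPoint-label : ∀ {A} → A < suc T → ∀ s → fromPoint (label A s) ≡ A ·2+ s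
  fromPoint-label         A<1+T false = fromPoint-small A<1+T
  fromPoint-label {zero}  _     true  = fromPoint-∞
  fromPoint-label {suc A} A<1+T true  = begin
    fromPoint (q ∸ suc A)          ≡⟨ fromPoint-large (q∸-≥ A<1+T) (ℕₚ.<⇒≢ (ℕₚ.∸-monoʳ-< z<s 1+A≤q)) ⟩
    (q ∸ (q ∸ suc A)) ·2+ true     ≡⟨ cong (_·2+ true) (ℕₚ.m∸[m∸n]≡n 1+A≤q) ⟩
    suc A ·2+ true                 ∎
    where
    open ≡-Reasoning
    1+A≤q : suc A ≤ q
    1+A≤q = ℕₚ.<⇒≤ (ℕₚ.<-≤-trans A<1+T T<q)

  toPoint-fromPoint : ∀ {y} → y < suc q → toPoint (fromPoint y) ≡ y
  toPoint-fromPoint {y} y<1+q with y ℕₚ.<? suc T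
  ... | yes y<1+T = trans (cong toPoint (fromPoint-small y<1+T)) (toPoint-·2+ y false)
  ... | no y≮1+T with y ℕₚ.≟ q
  ...   | yes refl = cong toPoint fromPoint-∞
  ...   | no y≢q = begin
    toPoint (fromPoint y)          ≡⟨ cong toPoint (fromPoint-large (ℕₚ.≮⇒≥ y≮1+T) y≢q) ⟩
    toPoint ((q ∸ y) ·2+ true)     ≡⟨ toPoint-·2+ (q ∸ y) true ⟩
    label (q ∸ y) true             ≡⟨ label-true (ℕₚ.<⇒≢ (ℕₚ.m<n⇒0<n∸m y<q) ∘ sym) ⟩
    q ∸ (q ∸ y)                    ≡⟨ ℕₚ.m∸[m∸n]≡n (ℕₚ.<⇒≤ y<q) ⟩
    y                              ∎
    where
    open ≡-Reasoning
    y<q : y < q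
    y<q = ℕₚ.≤∧≢⇒< (ℕₚ.≤-pred y<1+q) y≢q

  fromPoint-< : ∀ {y} → y < suc q → fromPoint y < suc T ℕ.* 2
  fromPoint-< {y} y<1+q with y ℕₚ.<? suc T
  ... | yes y<1+T = subst (_< suc T ℕ.* 2) (sym (fromPoint-small y<1+T)) (·2+-< false y<1+T)
  ... | no y≮1+T with y ℕₚ.≟ q
  ...   | yes refl = subst (_< suc T ℕ.* 2) (sym fromPoint-∞) (s≤s (s≤s z≤n))
  ...   | no y≢q = subst (_< suc T ℕ.* 2) (sym (fromPoint-large (ℕₚ.≮⇒≥ y≮1+T) y≢q)) (·2+-< true (q∸-< (ℕₚ.≮⇒≥ y≮1+T)))

  pairedRoundRobin : Factorisation (suc T ℕ.* 2) q
  pairedRoundRobin = relabel roundRobin toPoint fromPoint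
    (λ {a} a<k → label-< (⌊/2⌋-< a<k) (odd a))
    fromPoint-<
    (λ {a} a<k → trans (fromPoint-label (⌊/2⌋-< a<k) (odd a)) (⌊/2⌋·2+odd a))
    toPoint-fromPoint

  pairedRoundRobin-pair : ∀ {A} → A < suc T → Factorisation.colour pairedRoundRobin (A ·2+ false) (A ·2+ true) ≡ 0
  pairedRoundRobin-pair {A} A<1+T = trans (cong₂ colour (toPoint-·2+ A false) (toPoint-·2+ A true)) (pair A A<1+T)
    where
    pair : ∀ A → A < suc T → colour (label A false) (label A true) ≡ 0
    pair zero    _      = colour-∞ʳ (ℕₚ.<⇒≢ z<s)
    pair (suc A) A<1+T  = begin
      colour (suc A) (q ∸ suc A)      ≡⟨ colour-finite (ℕₚ.<⇒≢ 1+A<q) (ℕₚ.<⇒≢ (ℕₚ.∸-monoʳ-< z<s (ℕₚ.<⇒≤ 1+A<q))) ⟩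
      (suc A ℕ.+ (q ∸ suc A)) % q     ≡⟨ cong (_% q) (ℕₚ.m+[n∸m]≡n (ℕₚ.<⇒≤ 1+A<q)) ⟩
      q % q                           ≡⟨ n%n≡0 q ⟩
      0                               ∎
      where
      open ≡-Reasoning
      1+A<q : suc A < q
      1+A<q = ℕₚ.<-≤-trans A<1+T T<q

-- Colour 0 matches each pair {2a, 2a+1}; the four edges between the pairs of an edge ab of colour γ
-- form the matchings 2γ+1 (even–even, odd–odd) and 2γ+2 (even–odd).
module Doubling {k c} (R : Factorisation k c) where
  private
    module R = Factorisation R

  pairWeight : (ℕ → ℕ → ℤ) → Bool → ℕ → ℕ → ℤ
  pairWeight f e a b = if does (a ℕₚ.<? b) then f (a ·2+ false) (b ·2+ e) + f (a ·2+ true) (b ·2+ not e) else 0ℤ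

  colour : ℕ → ℕ → ℕ
  colour v u = if does (⌊ v /2⌋ ℕₚ.≟ ⌊ u /2⌋) then 0
               else suc (R.colour ⌊ v /2⌋ ⌊ u /2⌋ ·2+ (odd v xor odd u))

  partner : ℕ → ℕ → ℕ
  partner zero    v = ⌊ v /2⌋ ·2+ not (odd v)
  partner (suc γ) v = R.partner ⌊ γ /2⌋ ⌊ v /2⌋ ·2+ (odd v xor odd γ)

  colour-same : ∀ {v u} → ⌊ v /2⌋ ≡ ⌊ u /2⌋ → colour v u ≡ 0
  colour-same {v} {u} = if-yes (⌊ v /2⌋ ℕₚ.≟ ⌊ u /2⌋)

  colour-different : ∀ {v u} → ⌊ v /2⌋ ≢ ⌊ u /2⌋ →
                     colour v u ≡ suc (R.colour ⌊ v /2⌋ ⌊ u /2⌋ ·2+ (odd v xor odd u))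
  colour-different {v} {u} = if-no (⌊ v /2⌋ ℕₚ.≟ ⌊ u /2⌋)

  ⌊partner/2⌋ : ∀ γ v → ⌊ partner (suc γ) v /2⌋ ≡ R.partner ⌊ γ /2⌋ ⌊ v /2⌋
  ⌊partner/2⌋ γ v = ⌊·2+/2⌋ (R.partner ⌊ γ /2⌋ ⌊ v /2⌋) (odd v xor odd γ)

  odd-partner : ∀ γ v → odd (partner (suc γ) v) ≡ odd v xor odd γ
  odd-partner γ v = odd-·2+ (R.partner ⌊ γ /2⌋ ⌊ v /2⌋) (odd v xor odd γ)

  double : Factorisation (k ℕ.* 2) (suc (c ℕ.* 2))
  double = record
    { colour         = colour
    ; partner        = partner
    ; colour-sym     = colour-sym
    ; colour-<       = colour-<
    ; partner-<      = partner-<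
    ; partner-≢      = partner-≢
    ; colour-partner = colour-partner
    ; partner-unique = partner-unique
    }
    where
    ⌊γ/2⌋<c : ∀ {γ} → suc γ < suc (c ℕ.* 2) → ⌊ γ /2⌋ < c
    ⌊γ/2⌋<c (s≤s γ<2c) = ⌊/2⌋-< γ<2c

    colour-sym : ∀ v u → colour v u ≡ colour u v
    colour-sym v u with ⌊ v /2⌋ ℕₚ.≟ ⌊ u /2⌋
    ... | yes same = trans (colour-same same) (sym (colour-same (sym same)))
    ... | no  diff = begin
      colour v u
        ≡⟨ colour-different diff ⟩
      suc (R.colour ⌊ v /2⌋ ⌊ u /2⌋ ·2+ (odd v xor odd u))
        ≡⟨ cong₂ (λ x y → suc (x ·2+ y)) (R.colour-sym ⌊ v /2⌋ ⌊ u /2⌋) (xor-comm (odd v) (odd u)) ⟩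
      suc (R.colour ⌊ u /2⌋ ⌊ v /2⌋ ·2+ (odd u xor odd v))
        ≡⟨ colour-different (diff ∘ sym) ⟨
      colour u v ∎
      where open ≡-Reasoning

    colour-< : ∀ {v u} → v < k ℕ.* 2 → u < k ℕ.* 2 → colour v u < suc (c ℕ.* 2)
    colour-< {v} {u} v<2k u<2k with ⌊ v /2⌋ ℕₚ.≟ ⌊ u /2⌋
    ... | yes same = subst (_< suc (c ℕ.* 2)) (sym (colour-same same)) z<s
    ... | no  diff = subst (_< suc (c ℕ.* 2)) (sym (colour-different diff))
                       (s≤s (·2+-< (odd v xor odd u) (R.colour-< (⌊/2⌋-< v<2k) (⌊/2⌋-< u<2k))))

    partner-< : ∀ {γ v} → γ < suc (c ℕ.* 2) → v < k ℕ.* 2 → partner γ v < k ℕ.* 2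
    partner-< {zero}  {v} _   v<2k = ·2+-< (not (odd v)) (⌊/2⌋-< {k = k} v<2k)
    partner-< {suc γ} {v} γ<m v<2k = ·2+-< (odd v xor odd γ) (R.partner-< (⌊γ/2⌋<c γ<m) (⌊/2⌋-< v<2k))

    partner-≢ : ∀ {γ v} → γ < suc (c ℕ.* 2) → v < k ℕ.* 2 → partner γ v ≢ v
    partner-≢ {zero}  {v} _   _    eq = ·2+-not-≢ ⌊ v /2⌋ (odd v) (trans eq (sym (⌊/2⌋·2+odd v)))
    partner-≢ {suc γ} {v} γ<m v<2k eq =
      R.partner-≢ (⌊γ/2⌋<c γ<m) (⌊/2⌋-< v<2k) (trans (sym (⌊partner/2⌋ γ v)) (cong ⌊_/2⌋ eq))

    colour-partner : ∀ {γ v} → γ < suc (c ℕ.* 2) → v < k ℕ.* 2 → colour v (partner γ v) ≡ γ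
    colour-partner {zero}  {v} _   _    = colour-same (sym (⌊·2+/2⌋ ⌊ v /2⌋ (not (odd v))))
    colour-partner {suc γ} {v} γ<m v<2k = begin
      colour v (partner (suc γ) v)
        ≡⟨ colour-different different ⟩
      suc (R.colour a ⌊ partner (suc γ) v /2⌋ ·2+ (odd v xor odd (partner (suc γ) v)))
        ≡⟨ cong₂ (λ x y → suc (R.colour a x ·2+ y)) (⌊partner/2⌋ γ v)
                 (trans (cong (odd v xor_) (odd-partner γ v)) (xor-cancelˡ (odd v) (odd γ))) ⟩
      suc (R.colour a (R.partner ⌊ γ /2⌋ a) ·2+ odd γ)
        ≡⟨ cong (λ x → suc (x ·2+ odd γ)) (R.colour-partner (⌊γ/2⌋<c γ<m) (⌊/2⌋-< v<2k)) ⟩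
      suc (⌊ γ /2⌋ ·2+ odd γ)
        ≡⟨ cong suc (⌊/2⌋·2+odd γ) ⟩
      suc γ ∎
      where
      open ≡-Reasoning
      a = ⌊ v /2⌋
      different : a ≢ ⌊ partner (suc γ) v /2⌋
      different eq = R.partner-≢ (⌊γ/2⌋<c γ<m) (⌊/2⌋-< v<2k) (sym (trans eq (⌊partner/2⌋ γ v)))

    partner-unique : ∀ {γ v w} → γ < suc (c ℕ.* 2) → v < k ℕ.* 2 → w < k ℕ.* 2 → w ≢ v →
                     colour v w ≡ γ → w ≡ partner γ v
    partner-unique {zero} {v} {w} _ _ _ w≢v vw≡0 with ⌊ v /2⌋ ℕₚ.≟ ⌊ w /2⌋
    ... | yes same = ⌊/2⌋-odd-injective
                       (trans (sym same) (sym (⌊·2+/2⌋ ⌊ v /2⌋ (not (odd v)))))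
                       (trans (¬-not (w≢v ∘ ⌊/2⌋-odd-injective (sym same))) (sym (odd-·2+ ⌊ v /2⌋ (not (odd v)))))
    ... | no  diff = ⊥-elim (ℕₚ.0≢1+n (sym (trans (sym (colour-different diff)) vw≡0)))
    partner-unique {suc γ} {v} {w} γ<m v<2k w<2k w≢v vw≡γ with ⌊ v /2⌋ ℕₚ.≟ ⌊ w /2⌋
    ... | yes same = ⊥-elim (ℕₚ.0≢1+n (trans (sym (colour-same same)) vw≡γ))
    ... | no  diff = ⌊/2⌋-odd-injective
                       (trans halves (sym (⌊partner/2⌋ γ v)))
                       (trans (sym (xor-cancelˡ (odd v) (odd w)))
                              (trans (cong (odd v xor_) parities) (sym (odd-partner γ v))))
      where
      digits : R.colour ⌊ v /2⌋ ⌊ w /2⌋ ·2+ (odd v xor odd w) ≡ γ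
      digits = ℕₚ.suc-injective (trans (sym (colour-different diff)) vw≡γ)
      parities : odd v xor odd w ≡ odd γ
      parities = trans (sym (odd-·2+ (R.colour ⌊ v /2⌋ ⌊ w /2⌋) (odd v xor odd w))) (cong odd digits)
      halves : ⌊ w /2⌋ ≡ R.partner ⌊ γ /2⌋ ⌊ v /2⌋
      halves = R.partner-unique (⌊γ/2⌋<c γ<m) (⌊/2⌋-< v<2k) (⌊/2⌋-< w<2k) (diff ∘ sym)
                 (trans (sym (⌊·2+/2⌋ (R.colour ⌊ v /2⌋ ⌊ w /2⌋) (odd v xor odd w))) (cong ⌊_/2⌋ digits))

  partner-0-·2+ : ∀ a s → partner 0 (a ·2+ s) ≡ a ·2+ not s
  partner-0-·2+ a s = cong₂ _·2+_ (⌊·2+/2⌋ a s) (cong not (odd-·2+ a s))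

  partner-suc-·2+ : ∀ γ a s → partner (suc γ) (a ·2+ s) ≡ R.partner ⌊ γ /2⌋ a ·2+ (s xor odd γ)
  partner-suc-·2+ γ a s = cong₂ _·2+_ (cong (R.partner ⌊ γ /2⌋) (⌊·2+/2⌋ a s)) (cong (_xor odd γ) (odd-·2+ a s))

  matchingWeight-0 : ∀ (f : ℕ → ℕ → ℤ) →
    matchingWeight (k ℕ.* 2) f (partner 0) ≡ ∑< k (λ a → f (a ·2+ false) (a ·2+ true))
  matchingWeight-0 f = trans (∑<-*2 k term) (∑<-cong k λ a _ → begin
    term (a ·2+ false) + term (a ·2+ true)
      ≡⟨ cong₂ _+_ (cong (fromSmaller f (a ·2+ false)) (partner-0-·2+ a false))
                   (cong (fromSmaller f (a ·2+ true)) (partner-0-·2+ a true)) ⟩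
    fromSmaller f (a ·2+ false) (a ·2+ true) + fromSmaller f (a ·2+ true) (a ·2+ false)
      ≡⟨ cong₂ _+_ (if-yes (a ·2+ false ℕₚ.<? a ·2+ true) (·2+-false<true a))
                   (if-no (a ·2+ true ℕₚ.<? a ·2+ false) (ℕₚ.<⇒≯ (·2+-false<true a))) ⟩
    f (a ·2+ false) (a ·2+ true) + 0ℤ
      ≡⟨ ℤₚ.+-identityʳ _ ⟩
    f (a ·2+ false) (a ·2+ true) ∎)
    where
    open ≡-Reasoning
    term : ℕ → ℤ
    term v = fromSmaller f v (partner 0 v)

  matchingWeight-suc : ∀ (f : ℕ → ℕ → ℤ) {γ} → ⌊ γ /2⌋ < c →
    matchingWeight (k ℕ.* 2) f (partner (suc γ)) ≡ ∑< k (λ a → pairWeight f (odd γ) a (R.partner ⌊ γ /2⌋ a))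
  matchingWeight-suc f {γ} γ<c = trans (∑<-*2 k term) (∑<-cong k pair)
    where
    open ≡-Reasoning
    b : ℕ → ℕ
    b = R.partner ⌊ γ /2⌋
    term : ℕ → ℤ
    term v = fromSmaller f v (partner (suc γ) v)
    if-+ : ∀ x {y z} → (if x then y else 0ℤ) + (if x then z else 0ℤ) ≡ (if x then y + z else 0ℤ)
    if-+ true  = refl
    if-+ false = refl
    pair : ∀ a → a < k → term (a ·2+ false) + term (a ·2+ true) ≡ pairWeight f (odd γ) a (b a)
    pair a a<k = begin
      term (a ·2+ false) + term (a ·2+ true)
        ≡⟨ cong₂ _+_ (cong (fromSmaller f (a ·2+ false)) (partner-suc-·2+ γ a false))
                     (cong (fromSmaller f (a ·2+ true)) (partner-suc-·2+ γ a true)) ⟩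
      fromSmaller f (a ·2+ false) (b a ·2+ odd γ) + fromSmaller f (a ·2+ true) (b a ·2+ not (odd γ))
        ≡⟨ cong₂ _+_ (cong (λ x → if x then f (a ·2+ false) (b a ·2+ odd γ) else 0ℤ) (does-<?-·2+ false (odd γ) a≢b))
                     (cong (λ x → if x then f (a ·2+ true) (b a ·2+ not (odd γ)) else 0ℤ)
                           (does-<?-·2+ true (not (odd γ)) a≢b)) ⟩
      (if does (a ℕₚ.<? b a) then f (a ·2+ false) (b a ·2+ odd γ) else 0ℤ)
        + (if does (a ℕₚ.<? b a) then f (a ·2+ true) (b a ·2+ not (odd γ)) else 0ℤ)
        ≡⟨ if-+ (does (a ℕₚ.<? b a)) ⟩
      pairWeight f (odd γ) a (b a) ∎
      where
      a≢b : a ≢ b a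
      a≢b = R.partner-≢ γ<c a<k ∘ sym

2ℤ -2ℤ : ℤ
2ℤ  = ℤ.+ 2
-2ℤ = - 2ℤ

data FlowValue : ℤ → Set where
  val+1 : FlowValue 1ℤ
  val-1 : FlowValue -1ℤ
  val+2 : FlowValue 2ℤ
  val-2 : FlowValue -2ℤ

FlowValue-neg : ∀ {z} → FlowValue z → FlowValue (- z)
FlowValue-neg val+1 = val-1
FlowValue-neg val-1 = val+1
FlowValue-neg val+2 = val-2
FlowValue-neg val-2 = val+2

FlowValue⇒3-flow : ∀ {z} → FlowValue z → z ≢ 0ℤ × ∣ z ∣ < 3
FlowValue⇒3-flow val+1 = (λ ()) , s≤s (s≤s z≤n)
FlowValue⇒3-flow val-1 = (λ ()) , s≤s (s≤s z≤n)
FlowValue⇒3-flow val+2 = (λ ()) , s≤s (s≤s (s≤s z≤n))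
FlowValue⇒3-flow val-2 = (λ ()) , s≤s (s≤s (s≤s z≤n))

sign : Bool → ℤ
sign false = 1ℤ
sign true  = -1ℤ

signed : Bool → ℤ → ℤ
signed false z = z
signed true  z = - z

indicator : Bool → ℤ
indicator b = if b then 1ℤ else 0ℤ

FlowValue-sign : ∀ b → FlowValue (sign b)
FlowValue-sign false = val+1
FlowValue-sign true  = val-1

FlowValue-signed : ∀ b {z} → FlowValue z → FlowValue (signed b z)
FlowValue-signed false v = v
FlowValue-signed true  v = FlowValue-neg v

-- A flow on K_(4t): the vertex (A ·2+ i) ·2+ s is the vertex (i, s) of the A-th of t blocks of four.
module BlockFlow (t : ℕ) where

  block : ℕ → ℕ
  block v = ⌊ ⌊ v /2⌋ /2⌋

  row side : ℕ → Bool
  row  v = odd ⌊ v /2⌋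
  side v = odd v

  -- the degree of A in the path 0 — 1 — ⋯ — (t-1) of blocks
  hasLeft hasRight : ℕ → Bool
  hasLeft zero    = false
  hasLeft (suc _) = true
  hasRight A = does (suc A ℕₚ.<? t)

  pathDegree : ℕ → ℤ
  pathDegree A = indicator (hasLeft A) + indicator (hasRight A)

  -- 1, -1, 1, -1, …, corrected to 1, -2, 1, -1, … when t is odd so that the sum vanishes
  correction : ℕ → ℤ
  correction A = if does (A ℕₚ.≟ 1) ∧ odd t then -1ℤ else 0ℤ

  rung : ℕ → ℤ
  rung A = sign (odd A) + correction A

  inner : ℕ → Bool → Bool → Bool → Bool → ℤ
  inner A i s j s′ =
    if i xor j then (if s xor s′ then signed (i xor s) (pathDegree A) else - rung A)
    else (if s xor s′ then rung A else 0ℤ)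

  adjacent : Bool → Bool → Bool → ℤ
  adjacent false false false = 1ℤ
  adjacent false false true  = -2ℤ
  adjacent false true  false = -1ℤ
  adjacent false true  true  = 2ℤ
  adjacent true  false false = 2ℤ
  adjacent true  false true  = -2ℤ
  adjacent true  true  false = -1ℤ
  adjacent true  true  true  = 1ℤ

  between : Bool → Bool → Bool → Bool → ℤ
  between true  d i j = adjacent d i j
  between false d i j = sign j

  -- from (i, s) in a block to (j, s′) in a later block, which is the next one iff near
  cross : Bool → Bool → Bool → Bool → Bool → ℤ
  cross near i s j s′ = signed s (between near (s xor s′) i j)

  blockFlow : ℕ → Bool → Bool → ℕ → Bool → Bool → ℤ
  blockFlow A i s B j s′ =
    if does (A ℕₚ.≟ B) then inner A i s j s′
    else if does (A ℕₚ.<? B) then cross (does (suc A ℕₚ.≟ B)) i s j s′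
    else cross (does (suc B ℕₚ.≟ A)) j s′ i s

  flow : ℕ → ℕ → ℤ
  flow v u = blockFlow (block v) (row v) (side v) (block u) (row u) (side u)

  blockFlow-≡ : ∀ A i s j s′ → blockFlow A i s A j s′ ≡ inner A i s j s′
  blockFlow-≡ A i s j s′ = if-yes (A ℕₚ.≟ A) refl

  blockFlow-< : ∀ {A B} i s j s′ → A < B → blockFlow A i s B j s′ ≡ cross (does (suc A ℕₚ.≟ B)) i s j s′
  blockFlow-< {A} {B} i s j s′ A<B = trans (if-no (A ℕₚ.≟ B) (ℕₚ.<⇒≢ A<B)) (if-yes (A ℕₚ.<? B) A<B)

  blockFlow-> : ∀ {A B} i s j s′ → B < A → blockFlow A i s B j s′ ≡ cross (does (suc B ℕₚ.≟ A)) j s′ i s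
  blockFlow-> {A} {B} i s j s′ B<A = trans (if-no (A ℕₚ.≟ B) (ℕₚ.>⇒≢ B<A)) (if-no (A ℕₚ.<? B) (ℕₚ.<⇒≯ B<A))

  block-·2+ : ∀ A i s → block (A ·2+ i ·2+ s) ≡ A
  block-·2+ A i s = trans (cong ⌊_/2⌋ (⌊·2+/2⌋ (A ·2+ i) s)) (⌊·2+/2⌋ A i)

  row-·2+ : ∀ A i s → row (A ·2+ i ·2+ s) ≡ i
  row-·2+ A i s = trans (cong odd (⌊·2+/2⌋ (A ·2+ i) s)) (odd-·2+ A i)

  flow≡blockFlow : ∀ {v u A i s B j s′} →
    block v ≡ A → row v ≡ i → side v ≡ s → block u ≡ B → row u ≡ j → side u ≡ s′ →
    flow v u ≡ blockFlow A i s B j s′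
  flow≡blockFlow refl refl refl refl refl refl = refl

  flow-·2+ : ∀ v B j s′ → flow v (B ·2+ j ·2+ s′) ≡ blockFlow (block v) (row v) (side v) B j s′
  flow-·2+ v B j s′ = flow≡blockFlow {v} refl refl refl (block-·2+ B j s′) (row-·2+ B j s′) (odd-·2+ (B ·2+ j) s′)

  flow-pairs : ∀ a s b s′ → flow (a ·2+ s) (b ·2+ s′) ≡ blockFlow ⌊ a /2⌋ (odd a) s ⌊ b /2⌋ (odd b) s′
  flow-pairs a s b s′ = flow≡blockFlow {a ·2+ s} {b ·2+ s′}
    (cong ⌊_/2⌋ (⌊·2+/2⌋ a s)) (cong odd (⌊·2+/2⌋ a s)) (odd-·2+ a s)
    (cong ⌊_/2⌋ (⌊·2+/2⌋ b s′)) (cong odd (⌊·2+/2⌋ b s′)) (odd-·2+ b s′)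

  flow-digits : ∀ A i s B j s′ → flow (A ·2+ i ·2+ s) (B ·2+ j ·2+ s′) ≡ blockFlow A i s B j s′
  flow-digits A i s B j s′ = flow≡blockFlow {A ·2+ i ·2+ s} {B ·2+ j ·2+ s′}
    (block-·2+ A i s) (row-·2+ A i s) (odd-·2+ (A ·2+ i) s) (block-·2+ B j s′) (row-·2+ B j s′) (odd-·2+ (B ·2+ j) s′)

  inner-sym : ∀ A i s j s′ → inner A i s j s′ ≡ inner A j s′ i s
  inner-sym A false false false false = refl
  inner-sym A false false false true  = refl
  inner-sym A false false true  false = refl
  inner-sym A false false true  true  = refl
  inner-sym A false true  false false = refl
  inner-sym A false true  false true  = refl
  inner-sym A false true  true  false = refl
  inner-sym A false true  true  true  = refl
  inner-sym A true  false false false = refl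
  inner-sym A true  false false true  = refl
  inner-sym A true  false true  false = refl
  inner-sym A true  false true  true  = refl
  inner-sym A true  true  false false = refl
  inner-sym A true  true  false true  = refl
  inner-sym A true  true  true  false = refl
  inner-sym A true  true  true  true  = refl

  inner-rung : ∀ A i → inner A i false i true ≡ rung A
  inner-rung A false = refl
  inner-rung A true  = refl

  inner-diagonal : ∀ A i s → inner A i s i s ≡ 0ℤ
  inner-diagonal A false false = refl
  inner-diagonal A false true  = refl
  inner-diagonal A true  false = refl
  inner-diagonal A true  true  = refl

  blockFlow-sym : ∀ A i s B j s′ → blockFlow A i s B j s′ ≡ blockFlow B j s′ A i s
  blockFlow-sym A i s B j s′ with ℕₚ.<-cmp A B
  ... | tri< A<B _ _ = trans (blockFlow-< i s j s′ A<B) (sym (blockFlow-> j s′ i s A<B))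
  ... | tri≈ _ refl _ = trans (blockFlow-≡ A i s j s′) (trans (inner-sym A i s j s′) (sym (blockFlow-≡ A j s′ i s)))
  ... | tri> _ _ B<A = trans (blockFlow-> i s j s′ B<A) (sym (blockFlow-< j s′ i s B<A))

  flow-sym : ∀ v u → flow v u ≡ flow u v
  flow-sym v u = blockFlow-sym (block v) (row v) (side v) (block u) (row u) (side u)

  flow-diagonal : ∀ v → flow v v ≡ 0ℤ
  flow-diagonal v =
    trans (blockFlow-≡ (block v) (row v) (side v) (row v) (side v)) (inner-diagonal (block v) (row v) (side v))

  rung-value : ∀ A → FlowValue (rung A)
  rung-value zero          = val+1
  rung-value (suc zero) with odd t
  ... | true  = val-2
  ... | false = val-1
  rung-value (suc (suc A)) = subst FlowValue (sym (ℤₚ.+-identityʳ (sign (odd A)))) (FlowValue-sign (odd A))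

  FlowValue-degree : ∀ l r → l ≡ true ⊎ r ≡ true → FlowValue (indicator l + indicator r)
  FlowValue-degree true  true  _         = val+2
  FlowValue-degree true  false _         = val+1
  FlowValue-degree false true  _         = val+1
  FlowValue-degree false false (inj₁ ())
  FlowValue-degree false false (inj₂ ())

  pathDegree-value : 1 < t → ∀ A → FlowValue (pathDegree A)
  pathDegree-value 1<t zero    = FlowValue-degree false (hasRight zero) (inj₂ (dec-true (1 ℕₚ.<? t) 1<t))
  pathDegree-value 1<t (suc A) = FlowValue-degree true (hasRight (suc A)) (inj₁ refl)

  inner-value : 1 < t → ∀ A i s j s′ → ¬ (i ≡ j × s ≡ s′) → FlowValue (inner A i s j s′)
  inner-value 1<t A false false false false distinct = ⊥-elim (distinct (refl , refl))
  inner-value 1<t A false false false true  _        = rung-value A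
  inner-value 1<t A false false true  false _        = FlowValue-neg (rung-value A)
  inner-value 1<t A false false true  true  _        = FlowValue-signed false (pathDegree-value 1<t A)
  inner-value 1<t A false true  false false _        = rung-value A
  inner-value 1<t A false true  false true  distinct = ⊥-elim (distinct (refl , refl))
  inner-value 1<t A false true  true  false _        = FlowValue-signed true (pathDegree-value 1<t A)
  inner-value 1<t A false true  true  true  _        = FlowValue-neg (rung-value A)
  inner-value 1<t A true  false false false _        = FlowValue-neg (rung-value A)
  inner-value 1<t A true  false false true  _        = FlowValue-signed true (pathDegree-value 1<t A)
  inner-value 1<t A true  false true  false distinct = ⊥-elim (distinct (refl , refl))
  inner-value 1<t A true  false true  true  _        = rung-value A
  inner-value 1<t A true  true  false false _        = FlowValue-signed false (pathDegree-value 1<t A)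
  inner-value 1<t A true  true  false true  _        = FlowValue-neg (rung-value A)
  inner-value 1<t A true  true  true  false _        = rung-value A
  inner-value 1<t A true  true  true  true  distinct = ⊥-elim (distinct (refl , refl))

  between-value : ∀ near d i j → FlowValue (between near d i j)
  between-value false d     i     j     = FlowValue-sign j
  between-value true  false false false = val+1
  between-value true  false false true  = val-2
  between-value true  false true  false = val-1
  between-value true  false true  true  = val+2
  between-value true  true  false false = val+2
  between-value true  true  false true  = val-2
  between-value true  true  true  false = val-1
  between-value true  true  true  true  = val+1

  cross-value : ∀ near i s j s′ → FlowValue (cross near i s j s′)
  cross-value near i s j s′ = FlowValue-signed s (between-value near (s xor s′) i j)

  flow-value : 1 < t → ∀ {v u} → v ≢ u → FlowValue (flow v u)
  flow-value 1<t {v} {u} v≢u with ℕₚ.<-cmp (block v) (block u)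
  ... | tri< A<B _ _ = subst FlowValue (sym (blockFlow-< (row v) (side v) (row u) (side u) A<B))
                         (cross-value (does (suc (block v) ℕₚ.≟ block u)) (row v) (side v) (row u) (side u))
  ... | tri> _ _ B<A = subst FlowValue (sym (blockFlow-> (row v) (side v) (row u) (side u) B<A))
                         (cross-value (does (suc (block u) ℕₚ.≟ block v)) (row u) (side u) (row v) (side v))
  ... | tri≈ _ A≡B _ = subst FlowValue (sym (trans (flow≡blockFlow {v} {u} refl refl refl (sym A≡B) refl refl)
                                                   (blockFlow-≡ (block v) (row v) (side v) (row u) (side u))))
                         (inner-value 1<t (block v) (row v) (side v) (row u) (side u)
                           (λ (i≡j , s≡s′) → v≢u (⌊/2⌋-odd-injective (⌊/2⌋-odd-injective A≡B i≡j) s≡s′)))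

  quad-inner : ∀ A i s → quad (inner A i s) ≡ signed (i xor s) (pathDegree A)
  quad-inner A false false = cancel (rung A) (pathDegree A)
    where
    cancel : ∀ ρ δ → (0ℤ + ρ) + (- ρ + δ) ≡ δ
    cancel = solve-∀
  quad-inner A false true  = cancel (rung A) (pathDegree A)
    where
    cancel : ∀ ρ δ → (ρ + 0ℤ) + (- δ + - ρ) ≡ - δ
    cancel = solve-∀
  quad-inner A true  false = cancel (rung A) (pathDegree A)
    where
    cancel : ∀ ρ δ → (- ρ + - δ) + (0ℤ + ρ) ≡ - δ
    cancel = solve-∀
  quad-inner A true  true  = cancel (rung A) (pathDegree A)
    where
    cancel : ∀ ρ δ → (δ + - ρ) + (ρ + 0ℤ) ≡ δ
    cancel = solve-∀

  quad-cross-above : ∀ near i s → quad (cross near i s) ≡ (if near then - sign (i xor s) else 0ℤ)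
  quad-cross-above false false false = refl
  quad-cross-above false false true  = refl
  quad-cross-above false true  false = refl
  quad-cross-above false true  true  = refl
  quad-cross-above true  false false = refl
  quad-cross-above true  false true  = refl
  quad-cross-above true  true  false = refl
  quad-cross-above true  true  true  = refl

  quad-cross-below : ∀ near i s → quad (λ j s′ → cross near j s′ i s) ≡ (if near then - sign (i xor s) else 0ℤ)
  quad-cross-below false false false = refl
  quad-cross-below false false true  = refl
  quad-cross-below false true  false = refl
  quad-cross-below false true  true  = refl
  quad-cross-below true  false false = refl
  quad-cross-below true  false true  = refl
  quad-cross-below true  true  false = refl
  quad-cross-below true  true  true  = refl

  quad-blockFlow-below : ∀ {A B} i s → B < A →
    quad (blockFlow A i s B) ≡ (if does (suc B ℕₚ.≟ A) then - sign (i xor s) else 0ℤ)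
  quad-blockFlow-below i s B<A = trans (quad-cong (λ j s′ → blockFlow-> i s j s′ B<A)) (quad-cross-below _ i s)

  quad-blockFlow-above : ∀ {A B} i s → A < B →
    quad (blockFlow A i s B) ≡ (if does (suc A ℕₚ.≟ B) then - sign (i xor s) else 0ℤ)
  quad-blockFlow-above i s A<B = trans (quad-cong (λ j s′ → blockFlow-< i s j s′ A<B)) (quad-cross-above _ i s)

  quad-blockFlow-self : ∀ A i s → quad (blockFlow A i s A) ≡ signed (i xor s) (pathDegree A)
  quad-blockFlow-self A i s = trans (quad-cong (blockFlow-≡ A i s)) (quad-inner A i s)

  selfTerm aboveTerm belowTerm : ℕ → Bool → Bool → ℕ → ℤ
  selfTerm  A i s B = if does (B ℕₚ.≟ A) then signed (i xor s) (pathDegree A) else 0ℤ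
  aboveTerm A i s B = if does (suc A ℕₚ.≟ B) then - sign (i xor s) else 0ℤ
  belowTerm A i s B = if does (suc B ℕₚ.≟ A) then - sign (i xor s) else 0ℤ

  quad-blockFlow : ∀ A i s B → quad (blockFlow A i s B) ≡ selfTerm A i s B + aboveTerm A i s B + belowTerm A i s B
  quad-blockFlow A i s B with ℕₚ.<-cmp B A
  ... | tri< B<A _ _ = trans (quad-blockFlow-below i s B<A) (sym (begin
    selfTerm A i s B + aboveTerm A i s B + belowTerm A i s B
      ≡⟨ cong₂ (λ x y → x + y + belowTerm A i s B) (if-no (B ℕₚ.≟ A) (ℕₚ.<⇒≢ B<A))
               (if-no (suc A ℕₚ.≟ B) (ℕₚ.<⇒≢ (ℕₚ.<-trans B<A (ℕₚ.n<1+n A)) ∘ sym)) ⟩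
    0ℤ + belowTerm A i s B
      ≡⟨ ℤₚ.+-identityˡ (belowTerm A i s B) ⟩
    belowTerm A i s B ∎))
    where open ≡-Reasoning
  ... | tri≈ _ refl _ = trans (quad-blockFlow-self A i s) (sym (begin
    selfTerm A i s A + aboveTerm A i s A + belowTerm A i s A
      ≡⟨ cong₂ (λ x y → x + y + belowTerm A i s A) (if-yes (A ℕₚ.≟ A) refl) (if-no (suc A ℕₚ.≟ A) ℕₚ.1+n≢n) ⟩
    signed (i xor s) (pathDegree A) + 0ℤ + belowTerm A i s A
      ≡⟨ cong (signed (i xor s) (pathDegree A) + 0ℤ +_) (if-no (suc A ℕₚ.≟ A) ℕₚ.1+n≢n) ⟩
    signed (i xor s) (pathDegree A) + 0ℤ + 0ℤ
      ≡⟨ trans (ℤₚ.+-identityʳ _) (ℤₚ.+-identityʳ _) ⟩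
    signed (i xor s) (pathDegree A) ∎))
    where open ≡-Reasoning
  ... | tri> _ _ A<B = trans (quad-blockFlow-above i s A<B) (sym (begin
    selfTerm A i s B + aboveTerm A i s B + belowTerm A i s B
      ≡⟨ cong₂ (λ x y → x + aboveTerm A i s B + y) (if-no (B ℕₚ.≟ A) (ℕₚ.>⇒≢ A<B))
               (if-no (suc B ℕₚ.≟ A) (ℕₚ.>⇒≢ (ℕₚ.<-trans A<B (ℕₚ.n<1+n B)))) ⟩
    0ℤ + aboveTerm A i s B + 0ℤ
      ≡⟨ trans (ℤₚ.+-identityʳ _) (ℤₚ.+-identityˡ (aboveTerm A i s B)) ⟩
    aboveTerm A i s B ∎))
    where open ≡-Reasoning

  ∑<-selfTerm : ∀ {A} i s → A < t → ∑< t (selfTerm A i s) ≡ signed (i xor s) (pathDegree A)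
  ∑<-selfTerm {A} i s A<t =
    trans (∑<-single t A (λ B B≢A → if-no (B ℕₚ.≟ A) B≢A))
          (trans (if-yes (A ℕₚ.<? t) A<t) (if-yes (A ℕₚ.≟ A) refl))

  ∑<-aboveTerm : ∀ A i s → ∑< t (aboveTerm A i s) ≡ (if hasRight A then - sign (i xor s) else 0ℤ)
  ∑<-aboveTerm A i s =
    trans (∑<-single t (suc A) (λ B B≢1+A → if-no (suc A ℕₚ.≟ B) (B≢1+A ∘ sym)))
          (cong (λ x → if hasRight A then x else 0ℤ) (if-yes (suc A ℕₚ.≟ suc A) refl))

  ∑<-belowTerm : ∀ {A} i s → A < t → ∑< t (belowTerm A i s) ≡ (if hasLeft A then - sign (i xor s) else 0ℤ)
  ∑<-belowTerm {zero}  i s _   = ∑<-zero t (λ _ _ → refl)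
  ∑<-belowTerm {suc A} i s A<t =
    trans (∑<-single t A (λ B B≢A → if-no (suc B ℕₚ.≟ suc A) (B≢A ∘ ℕₚ.suc-injective)))
          (trans (if-yes (A ℕₚ.<? t) (ℕₚ.<-trans (ℕₚ.n<1+n A) A<t)) (if-yes (suc A ℕₚ.≟ suc A) refl))

  balance : ∀ σ l r → signed σ (indicator l + indicator r) + (if r then - sign σ else 0ℤ) + (if l then - sign σ else 0ℤ) ≡ 0ℤ
  balance false false false = refl
  balance false false true  = refl
  balance false true  false = refl
  balance false true  true  = refl
  balance true  false false = refl
  balance true  false true  = refl
  balance true  true  false = refl
  balance true  true  true  = refl

  flow-balanced : ∀ {v} → v < t ℕ.* 2 ℕ.* 2 → ∑< (t ℕ.* 2 ℕ.* 2) (flow v) ≡ 0ℤ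
  flow-balanced {v} v<4t = begin
    ∑< (t ℕ.* 2 ℕ.* 2) (flow v)
      ≡⟨ ∑<-quad t (flow v) ⟩
    ∑< t (λ B → quad (λ j s′ → flow v (B ·2+ j ·2+ s′)))
      ≡⟨ ∑<-cong t (λ B _ → trans (quad-cong (flow-·2+ v B)) (quad-blockFlow A i s B)) ⟩
    ∑< t (λ B → selfTerm A i s B + aboveTerm A i s B + belowTerm A i s B)
      ≡⟨ ∑<-distrib-+ t (λ B → selfTerm A i s B + aboveTerm A i s B) (belowTerm A i s) ⟩
    ∑< t (λ B → selfTerm A i s B + aboveTerm A i s B) + ∑< t (belowTerm A i s)
      ≡⟨ cong (_+ ∑< t (belowTerm A i s)) (∑<-distrib-+ t (selfTerm A i s) (aboveTerm A i s)) ⟩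
    ∑< t (selfTerm A i s) + ∑< t (aboveTerm A i s) + ∑< t (belowTerm A i s)
      ≡⟨ cong₂ _+_ (cong₂ _+_ (∑<-selfTerm i s A<t) (∑<-aboveTerm A i s)) (∑<-belowTerm i s A<t) ⟩
    signed (i xor s) (pathDegree A) + (if hasRight A then - sign (i xor s) else 0ℤ)
                                    + (if hasLeft A then - sign (i xor s) else 0ℤ)
      ≡⟨ balance (i xor s) (hasLeft A) (hasRight A) ⟩
    0ℤ ∎
    where
    open ≡-Reasoning
    A = block v
    i = row v
    s = side v
    A<t : A < t
    A<t = ⌊/2⌋-< (⌊/2⌋-< v<4t)

  flip : ∀ {A B} → A ≢ B → ∀ i j e → blockFlow A i false B j e + blockFlow A i true B j (not e) ≡ 0ℤ
  flip {A} {B} A≢B i j e with ℕₚ.<-cmp A B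
  ... | tri≈ _ A≡B _ = ⊥-elim (A≢B A≡B)
  ... | tri< A<B _ _ = trans (cong₂ _+_ (blockFlow-< i false j e A<B) (blockFlow-< i true j (not e) A<B))
                             (cancel (does (suc A ℕₚ.≟ B)) e)
    where
    cancel : ∀ near e → cross near i false j e + cross near i true j (not e) ≡ 0ℤ
    cancel near false = ℤₚ.+-inverseʳ (between near false i j)
    cancel near true  = ℤₚ.+-inverseʳ (between near true i j)
  ... | tri> _ _ B<A = trans (cong₂ _+_ (blockFlow-> i false j e B<A) (blockFlow-> i true j (not e) B<A))
                             (cancel (does (suc B ℕₚ.≟ A)) e)
    where
    cancel : ∀ near e → cross near j e i false + cross near j (not e) i true ≡ 0ℤ
    cancel near false = ℤₚ.+-inverseʳ (between near false j i)
    cancel near true  = ℤₚ.+-inverseˡ (between near true j i)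

  ∑<-alternating : ∀ n → ∑< n (sign ∘ odd) ≡ indicator (odd n)
  ∑<-alternating zero          = refl
  ∑<-alternating (suc zero)    = refl
  ∑<-alternating (suc (suc n)) = trans (cong (λ x → 1ℤ + (-1ℤ + x)) (∑<-alternating n)) (cancel (indicator (odd n)))
    where
    cancel : ∀ x → 1ℤ + (-1ℤ + x) ≡ x
    cancel = solve-∀

  ∑<-rung : 1 < t → ∑< t rung ≡ 0ℤ
  ∑<-rung 1<t = begin
    ∑< t rung                                            ≡⟨ ∑<-distrib-+ t (sign ∘ odd) correction ⟩
    ∑< t (sign ∘ odd) + ∑< t correction                  ≡⟨ cong₂ _+_ (∑<-alternating t) (∑<-single t 1 vanish) ⟩
    indicator (odd t) + (if does (1 ℕₚ.<? t) then correction 1 else 0ℤ)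
                                                         ≡⟨ cong (indicator (odd t) +_) (if-yes (1 ℕₚ.<? t) 1<t) ⟩
    indicator (odd t) + (if odd t then -1ℤ else 0ℤ)      ≡⟨ cancel (odd t) ⟩
    0ℤ                                                   ∎
    where
    open ≡-Reasoning
    vanish : ∀ A → A ≢ 1 → correction A ≡ 0ℤ
    vanish A A≢1 = cong (λ b → if b ∧ odd t then -1ℤ else 0ℤ) (dec-false (A ℕₚ.≟ 1) A≢1)
    cancel : ∀ b → indicator b + (if b then -1ℤ else 0ℤ) ≡ 0ℤ
    cancel true  = refl
    cancel false = refl

  ∑<-inner-across : 1 < t → ∀ e → ∑< t (λ A → inner A false false true e + inner A false true true (not e)) ≡ 0ℤ
  ∑<-inner-across 1<t false = begin
    ∑< t (λ A → - rung A + - rung A)     ≡⟨ ∑<-cong t (λ A _ → sym (ℤₚ.neg-distrib-+ (rung A) (rung A))) ⟩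
    ∑< t (λ A → - (rung A + rung A))     ≡⟨ ∑<-neg t (λ A → rung A + rung A) ⟩
    - ∑< t (λ A → rung A + rung A)       ≡⟨ cong -_ (∑<-distrib-+ t rung rung) ⟩
    - (∑< t rung + ∑< t rung)            ≡⟨ cong -_ (cong₂ _+_ (∑<-rung 1<t) (∑<-rung 1<t)) ⟩
    0ℤ                                   ∎
    where open ≡-Reasoning
  ∑<-inner-across 1<t true = ∑<-zero t (λ A _ → ℤₚ.+-inverseʳ (pathDegree A))

module Construction (T : ℕ) (1<t : 1 < suc T) where
  t : ℕ
  t = suc T

  open RoundRobin T using (q; pairedRoundRobin; pairedRoundRobin-pair)
  open Doubling pairedRoundRobin using (double; partner; pairWeight; matchingWeight-0; matchingWeight-suc)
  open BlockFlow t
  private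
    module Base = Factorisation pairedRoundRobin

  pair-colour : ∀ {A} → A < t → ∀ s → Base.colour (A ·2+ s) (A ·2+ not s) ≡ 0
  pair-colour A<t false = pairedRoundRobin-pair A<t
  pair-colour {A} A<t true = trans (Base.colour-sym (A ·2+ true) (A ·2+ false)) (pairedRoundRobin-pair A<t)

  base-partner-0 : ∀ {A} → A < t → ∀ s → Base.partner 0 (A ·2+ s) ≡ A ·2+ not s
  base-partner-0 {A} A<t s = sym (Base.partner-unique z<s (·2+-< s A<t) (·2+-< (not s) A<t)
    (·2+-not-≢ A s) (pair-colour A<t s))

  sameBlock-colour : ∀ {a b} → a < t ℕ.* 2 → b ≢ a → ⌊ a /2⌋ ≡ ⌊ b /2⌋ → Base.colour a b ≡ 0
  sameBlock-colour {a} {b} a<2t b≢a same =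
    trans (cong₂ Base.colour (sym (⌊/2⌋·2+odd a)) b≡) (pair-colour (⌊/2⌋-< a<2t) (odd a))
    where
    b≡ : b ≡ ⌊ a /2⌋ ·2+ not (odd a)
    b≡ = trans (sym (⌊/2⌋·2+odd b)) (cong₂ _·2+_ (sym same) (¬-not (b≢a ∘ ⌊/2⌋-odd-injective (sym same))))

  weight-0 : matchingWeight (t ℕ.* 2 ℕ.* 2) flow (partner 0) ≡ 0ℤ
  weight-0 = begin
    matchingWeight (t ℕ.* 2 ℕ.* 2) flow (partner 0)
      ≡⟨ matchingWeight-0 flow ⟩
    ∑< (t ℕ.* 2) (λ a → flow (a ·2+ false) (a ·2+ true))
      ≡⟨ ∑<-*2 t (λ a → flow (a ·2+ false) (a ·2+ true)) ⟩
    ∑< t (λ A → flow (A ·2+ false ·2+ false) (A ·2+ false ·2+ true) + flow (A ·2+ true ·2+ false) (A ·2+ true ·2+ true))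
      ≡⟨ ∑<-cong t (λ A _ → cong₂ _+_ (rungEdge A false) (rungEdge A true)) ⟩
    ∑< t (λ A → rung A + rung A)
      ≡⟨ ∑<-distrib-+ t rung rung ⟩
    ∑< t rung + ∑< t rung
      ≡⟨ cong₂ _+_ (∑<-rung 1<t) (∑<-rung 1<t) ⟩
    0ℤ ∎
    where
    open ≡-Reasoning
    rungEdge : ∀ A i → flow (A ·2+ i ·2+ false) (A ·2+ i ·2+ true) ≡ rung A
    rungEdge A i = trans (flow-digits A i false A i true) (trans (blockFlow-≡ A i false i true) (inner-rung A i))

  weight-withinBlocks : ∀ e → ∑< (t ℕ.* 2) (λ a → pairWeight flow e a (Base.partner 0 a)) ≡ 0ℤ
  weight-withinBlocks e = begin
    ∑< (t ℕ.* 2) (λ a → pairWeight flow e a (Base.partner 0 a))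
      ≡⟨ ∑<-*2 t (λ a → pairWeight flow e a (Base.partner 0 a)) ⟩
    ∑< t (λ A → pairWeight flow e (A ·2+ false) (Base.partner 0 (A ·2+ false))
              + pairWeight flow e (A ·2+ true) (Base.partner 0 (A ·2+ true)))
      ≡⟨ ∑<-cong t (λ A A<t → cong₂ _+_ (cong (pairWeight flow e (A ·2+ false)) (base-partner-0 A<t false))
                                          (cong (pairWeight flow e (A ·2+ true)) (base-partner-0 A<t true))) ⟩
    ∑< t (λ A → pairWeight flow e (A ·2+ false) (A ·2+ true) + pairWeight flow e (A ·2+ true) (A ·2+ false))
      ≡⟨ ∑<-cong t (λ A _ → pairs A) ⟩
    ∑< t (λ A → inner A false false true e + inner A false true true (not e))
      ≡⟨ ∑<-inner-across 1<t e ⟩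
    0ℤ ∎
    where
    open ≡-Reasoning
    pairs : ∀ A → pairWeight flow e (A ·2+ false) (A ·2+ true) + pairWeight flow e (A ·2+ true) (A ·2+ false)
                  ≡ inner A false false true e + inner A false true true (not e)
    pairs A = begin
      pairWeight flow e (A ·2+ false) (A ·2+ true) + pairWeight flow e (A ·2+ true) (A ·2+ false)
        ≡⟨ cong₂ _+_ (if-yes (A ·2+ false ℕₚ.<? A ·2+ true) (·2+-false<true A))
                     (if-no (A ·2+ true ℕₚ.<? A ·2+ false) (ℕₚ.<⇒≯ (·2+-false<true A))) ⟩
      flow (A ·2+ false ·2+ false) (A ·2+ true ·2+ e) + flow (A ·2+ false ·2+ true) (A ·2+ true ·2+ not e) + 0ℤ
        ≡⟨ ℤₚ.+-identityʳ _ ⟩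
      flow (A ·2+ false ·2+ false) (A ·2+ true ·2+ e) + flow (A ·2+ false ·2+ true) (A ·2+ true ·2+ not e)
        ≡⟨ cong₂ _+_ (trans (flow-digits A false false A true e) (blockFlow-≡ A false false true e))
                     (trans (flow-digits A false true A true (not e)) (blockFlow-≡ A false true true (not e))) ⟩
      inner A false false true e + inner A false true true (not e) ∎

  weight-betweenBlocks : ∀ {γ} e → γ < q → γ ≢ 0 → ∀ {a} → a < t ℕ.* 2 → pairWeight flow e a (Base.partner γ a) ≡ 0ℤ
  weight-betweenBlocks {γ} e γ<q γ≢0 {a} a<2t = if-0 (does (a ℕₚ.<? b)) (begin
    flow (a ·2+ false) (b ·2+ e) + flow (a ·2+ true) (b ·2+ not e)
      ≡⟨ cong₂ _+_ (flow-pairs a false b e) (flow-pairs a true b (not e)) ⟩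
    blockFlow ⌊ a /2⌋ (odd a) false ⌊ b /2⌋ (odd b) e + blockFlow ⌊ a /2⌋ (odd a) true ⌊ b /2⌋ (odd b) (not e)
      ≡⟨ flip differentBlocks (odd a) (odd b) e ⟩
    0ℤ ∎)
    where
    open ≡-Reasoning
    b = Base.partner γ a
    if-0 : ∀ x {y} → y ≡ 0ℤ → (if x then y else 0ℤ) ≡ 0ℤ
    if-0 true  y≡0 = y≡0
    if-0 false _   = refl
    differentBlocks : ⌊ a /2⌋ ≢ ⌊ b /2⌋
    differentBlocks same = γ≢0 (trans (sym (Base.colour-partner γ<q a<2t))
                                      (sameBlock-colour a<2t (Base.partner-≢ γ<q a<2t) same))

  weight-suc : ∀ {γ} → ⌊ γ /2⌋ < q → matchingWeight (t ℕ.* 2 ℕ.* 2) flow (partner (suc γ)) ≡ 0ℤ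
  weight-suc {γ} γ′<q with ⌊ γ /2⌋ ℕₚ.≟ 0
  ... | yes ⌊γ/2⌋≡0 = trans (matchingWeight-suc flow γ′<q)
                         (trans (cong (λ g → ∑< (t ℕ.* 2) (λ a → pairWeight flow (odd γ) a (Base.partner g a))) ⌊γ/2⌋≡0)
                                (weight-withinBlocks (odd γ)))
  ... | no ⌊γ/2⌋≢0 = trans (matchingWeight-suc flow γ′<q)
                            (∑<-zero (t ℕ.* 2) (λ a a<2t → weight-betweenBlocks (odd γ) γ′<q ⌊γ/2⌋≢0 a<2t))

  weight-zero : ∀ {γ} → γ < suc (q ℕ.* 2) → matchingWeight (t ℕ.* 2 ℕ.* 2) flow (partner γ) ≡ 0ℤ
  weight-zero {zero}  _         = weight-0
  weight-zero {suc γ} (s≤s γ<m) = weight-suc (⌊/2⌋-< γ<m)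

  nullOneFactorisation : NullOneFactorisation (t ℕ.* 2 ℕ.* 2) 3
  nullOneFactorisation = record
    { flow       = toZeroSumFlow flow flow-sym flow-diagonal
                     (λ _ _ v≢u → FlowValue⇒3-flow (flow-value 1<t v≢u)) flow-balanced
    ; factors    = toOneFactorisation double
    ; weightZero = λ c → trans (classWeight≡matchingWeight double flow c) (weight-zero (Finₚ.toℕ<n c))
    }

mainTheorem16 : ∀ (n : ℕ) → n ≢ 0 → 4 ∣ n → n ≢ 4 → NullOneFactorisation n 3
mainTheorem16 n n≢0 (divides zero          n≡0) _   = ⊥-elim (n≢0 n≡0)
mainTheorem16 n _   (divides (suc zero)    n≡4) n≢4 = ⊥-elim (n≢4 n≡4)
mainTheorem16 n _   (divides (suc (suc T)) n≡4t) _  =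
  subst (λ m → NullOneFactorisation m 3) (sym (trans n≡4t (sym (ℕₚ.*-assoc (suc (suc T)) 2 2))))
        (Construction.nullOneFactorisation (suc T) (s≤s (s≤s z≤n)))
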